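{- Let $n,d$ be positive integers and for $\sigma\in\mathcal P(n)$ let $$P_\sigma(d)=\sum_{\pi\ge\sigma}(-1)^{|\pi|}(d)_\pi\,(|\pi|-1)!.$$ Then for all $\sigma\in\mathcal{P}(n)$, $$P_\sigma (d) =-\sum_{\rho\in\mathcal P(n):\ \rho \lor \sigma = 1_n} d^{| \rho |}\, \mu (0_n, \rho).$$
   Context: $\mathcal{P}(n)$ is the set of partitions of $\{1,\dots,n\}$ ordered by refinement ($\pi\le\sigma$ iff each block of $\pi$ lies in a block of $\sigma$), with minimum $0_n$ (all singletons), maximum $1_n$ (one block), and join $\vee$ (least upper bound); $|\pi|$ is the number of blocks. $(d)_k=d(d-1)\cdots(d-k+1)$ and $(d)_\pi=\prod_{V\in\pi}(d)_{|V|}$. The Möbius function satisfies $\mu(0_n,\rho)=(-1)^{n-|\rho|}\prod_{V\in\rho}(|V|-1)!$. -}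

module Defs where

open import Data.Bool using (Bool; true; false; _∧_; not; if_then_else_)
open import Data.Nat as ℕ using (ℕ; zero; suc; _∸_; _≡ᵇ_)
open import Data.Integer as ℤ using (ℤ; +_; -_)
open import Data.List as List using (List; []; _∷_; map; concatMap; filter; upTo; allFin; deduplicateᵇ; length; foldr)
open import Data.Bool.ListAction using (all)
open import Data.Vec as Vec using (Vec; []; _∷_; lookup; toList; replicate; tabulate)
open import Data.Fin using (Fin; toℕ)

-- A partition of {1,…,n} (= Fin n) is encoded by a block-labelling
-- π : Vec ℕ n : elements i, j are in the same block iff their labels agree.
-- The set 𝒫(n) is enumerated (each partition exactly once) by its
-- restricted growth strings: first label 0, and each label is at most
-- the number of labels used before it.

Labelling : ℕ → Set
Labelling n = Vec ℕ n

-- rgs k m : all restricted-growth continuations of length k when the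
-- labels 0,…,m-1 have already been used.
rgs : (k m : ℕ) → List (Vec ℕ k)
rgs zero    m = [] ∷ []
rgs (suc k) m =
  concatMap (λ ℓ → map (ℓ ∷_) (rgs k (if ℓ ≡ᵇ m then suc m else m)))
            (upTo (suc m))

Partitions : (n : ℕ) → List (Labelling n)
Partitions n = rgs n 0

bot : (n : ℕ) → Labelling n
bot n = tabulate toℕ

top : (n : ℕ) → Labelling n
top n = replicate n 0

_≤ᵖ_ : ∀ {n} → Labelling n → Labelling n → Bool
_≤ᵖ_ {n} π σ =
  all (λ i → all (λ j → if lookup π i ≡ᵇ lookup π j
                         then lookup σ i ≡ᵇ lookup σ j else true)
                 (allFin n))
      (allFin n)

_≈ᵖ_ : ∀ {n} → Labelling n → Labelling n → Bool
π ≈ᵖ σ = (π ≤ᵖ σ) ∧ (σ ≤ᵖ π)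

-- ρ ∨ σ = 1_n : since ∨ is the least upper bound in 𝒫(n), this says
-- that every common upper bound τ ∈ 𝒫(n) of ρ and σ is ≥ 1_n.
joinIsTop : ∀ {n} → Labelling n → Labelling n → Bool
joinIsTop {n} ρ σ =
  all (λ τ → if (ρ ≤ᵖ τ) ∧ (σ ≤ᵖ τ) then top n ≤ᵖ τ else true) (Partitions n)

labels : ∀ {n} → Labelling n → List ℕ
labels π = deduplicateᵇ _≡ᵇ_ (toList π)

nBlocks : ∀ {n} → Labelling n → ℕ
nBlocks π = length (labels π)

blockSize : ∀ {n} → Labelling n → ℕ → ℕ
blockSize π ℓ = length (filter (λ x → x ℕ.≟ ℓ) (toList π))

fall : ℕ → ℕ → ℕ
fall d zero    = 1
fall d (suc k) = fall d k ℕ.* (d ∸ k)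

fallP : ∀ {n} → ℕ → Labelling n → ℕ
fallP d π = foldr (λ ℓ acc → fall d (blockSize π ℓ) ℕ.* acc) 1 (labels π)

Σℤ : ∀ {A : Set} → List A → (A → ℤ) → ℤ
Σℤ xs f = foldr (λ x acc → f x ℤ.+ acc) (+ 0) xs

-- The fuel bounds the recursion depth; chains in 𝒫(n) have length < n,
-- so fuel n+1 gives the true Möbius function.
mobiusF : ∀ {n} → ℕ → Labelling n → Labelling n → ℤ
mobiusF zero    x y = + 0
mobiusF {n} (suc f) x y =
  if x ≈ᵖ y then + 1
  else if x ≤ᵖ y
       then - Σℤ (filter (λ z → Data.Bool.T? ((x ≤ᵖ z) ∧ ((z ≤ᵖ y) ∧ not (y ≤ᵖ z))))
                         (Partitions n))
                 (mobiusF f x)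
       else + 0

mobius : ∀ {n} → Labelling n → Labelling n → ℤ
mobius {n} x y = mobiusF (suc n) x y

P : ∀ {n} → Labelling n → ℕ → ℤ
P {n} σ d =
  Σℤ (filter (λ π → Data.Bool.T? (σ ≤ᵖ π)) (Partitions n))
     (λ π → ((- + 1) ℤ.^ nBlocks π) ℤ.* (+ (fallP d π ℕ.* ((nBlocks π ∸ 1) ℕ.!))))

-- Expanding each falling factorial as (d)_π = Σ_{ρ ≤ π} d^|ρ| μ(0_n, ρ) and exchanging the
-- sums gives P_σ(d) = Σ_ρ d^|ρ| μ(0_n, ρ) Σ_{π ≥ σ ∨ ρ} (-1)^|π| (|π|-1)!.  The expansion is a
-- double count of the maps f : [n] → [d]: d^|ρ| of them are constant on the blocks of ρ, and
-- "ρ ≤ π and f constant on ρ" says ρ ≤ π ∧ ker f, so Σ_{z ≤ y} μ(0_n, z) = [y = 0_n] keeps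
-- exactly the maps injective on every block of π, of which there are (d)_π.  The inner sum is
-- -[σ ∨ ρ = 1_n]: grouping the partitions above one with j blocks by how they merge its blocks,
-- W(m, j+1) = m W(m, j) + W(m+1, j), and the weights (-1)^k (k-1)! make W(m, j+1) vanish for
-- m ≥ 1.  Partitions are handled as restricted growth strings; the join σ ∨ ρ is the restricted
-- growth string of the vector recording, at each position, its labels in all common upper bounds.

module Submission where

open import Defs
open import Data.Bool using (Bool; true; false; if_then_else_; T; T?; not; _∧_; _∨_)
open import Data.Bool.Properties using (T-∧; T-not-≡; ∧-comm; not-involutive; ∨-identityʳ; ∨-zeroʳ)
open import Data.Unit using (⊤; tt)
open import Data.Empty using (⊥; ⊥-elim)
open import Data.Maybe using (Maybe; just; nothing; is-just)
open import Data.Sum using (_⊎_; inj₁; inj₂)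
open import Data.Product using (_×_; _,_; proj₁; proj₂; ∃)
import Data.Product.Properties as ×P
open import Data.Nat as ℕ using (ℕ; zero; suc; _≤_; _<_; _∸_; _≡ᵇ_; _<ᵇ_; z≤n; s≤s; _!)
import Data.Nat.Properties as ℕP
open import Data.Fin using (Fin; zero; suc; toℕ)
import Data.Fin.Properties as FinP
open import Data.List as List using (List; []; _∷_; map; concatMap; filter; length; upTo; foldr; _++_; deduplicateᵇ)
import Data.List.Properties as ListP
open import Data.List.Membership.Propositional using (_∈_; find; lose)
open import Data.List.Membership.Propositional.Properties
  using (∈-map⁺; ∈-map⁻; ∈-concatMap⁺; ∈-concatMap⁻; ∈-upTo⁺; ∈-upTo⁻; ∈-filter⁺; ∈-filter⁻)
open import Data.List.Relation.Unary.All as All using (All)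
import Data.List.Relation.Unary.All.Properties as AllP
open import Data.List.Relation.Unary.Any using (here; there)
open import Data.Vec as Vec using (Vec; []; _∷_; lookup; toList; tabulate)
import Data.Vec.Properties as VecP
open import Data.Integer as ℤ using (ℤ; +_; -_; _+_; _*_; _-_; _^_; 0ℤ; 1ℤ)
import Data.Integer.Properties as ℤP
open import Data.Integer.Tactic.RingSolver using (solve-∀)
open import Function.Bundles using (Equivalence)
open import Relation.Nullary using (Dec; yes; no; does; ¬_; ¬?; _×-dec_; _→-dec_)
open import Relation.Nullary.Decidable using (isYes; toWitness; fromWitness)
open import Relation.Binary using (DecidableEquality)
open import Relation.Binary.PropositionalEquality

ind : Bool → ℤ → ℤ
ind b x = if b then x else 0ℤ

ind-* : ∀ b x y → ind b x * y ≡ ind b (x * y)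
ind-* true  x y = refl
ind-* false x y = ℤP.*-zeroˡ y

*-ind : ∀ b x y → x * ind b y ≡ ind b (x * y)
*-ind true  x y = refl
*-ind false x y = ℤP.*-zeroʳ x

ind-ind : ∀ b c x → ind b (ind c x) ≡ ind (b ∧ c) x
ind-ind true  c x = refl
ind-ind false c x = refl

ind-cong : ∀ b {x y} → (T b → x ≡ y) → ind b x ≡ ind b y
ind-cong true  eq = eq tt
ind-cong false eq = refl

split-ind : ∀ b c x → ind b x ≡ ind (b ∧ c) x + ind (b ∧ not c) x
split-ind false c     x = refl
split-ind true  true  x = sym (ℤP.+-identityʳ x)
split-ind true  false x = sym (ℤP.+-identityˡ x)

module _ {A : Set} where

  Σ-zero : (xs : List A) → Σℤ xs (λ _ → 0ℤ) ≡ 0ℤ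
  Σ-zero []       = refl
  Σ-zero (x ∷ xs) = trans (ℤP.+-identityˡ _) (Σ-zero xs)

  Σ-++ : (xs ys : List A) (F : A → ℤ) → Σℤ (xs ++ ys) F ≡ Σℤ xs F + Σℤ ys F
  Σ-++ []       ys F = sym (ℤP.+-identityˡ _)
  Σ-++ (x ∷ xs) ys F rewrite Σ-++ xs ys F = sym (ℤP.+-assoc (F x) _ _)

  Σ-cong-∈ : (xs : List A) {F G : A → ℤ} → (∀ x → x ∈ xs → F x ≡ G x) → Σℤ xs F ≡ Σℤ xs G
  Σ-cong-∈ []       eq = refl
  Σ-cong-∈ (x ∷ xs) eq = cong₂ ℤ._+_ (eq x (here refl)) (Σ-cong-∈ xs (λ y y∈ → eq y (there y∈)))

  Σ-cong : (xs : List A) {F G : A → ℤ} → (∀ x → F x ≡ G x) → Σℤ xs F ≡ Σℤ xs G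
  Σ-cong xs eq = Σ-cong-∈ xs (λ x _ → eq x)

  Σ-+ : (xs : List A) (F G : A → ℤ) → Σℤ xs (λ x → F x + G x) ≡ Σℤ xs F + Σℤ xs G
  Σ-+ []       F G = refl
  Σ-+ (x ∷ xs) F G rewrite Σ-+ xs F G = interchange (F x) (G x) (Σℤ xs F) (Σℤ xs G)
    where interchange : ∀ a b c d → (a + b) + (c + d) ≡ (a + c) + (b + d)
          interchange = solve-∀

  Σ-*ˡ : (xs : List A) (c : ℤ) (F : A → ℤ) → Σℤ xs (λ x → c * F x) ≡ c * Σℤ xs F
  Σ-*ˡ []       c F = sym (ℤP.*-zeroʳ c)
  Σ-*ˡ (x ∷ xs) c F rewrite Σ-*ˡ xs c F = sym (ℤP.*-distribˡ-+ c (F x) _)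

  Σ-*ʳ : (xs : List A) (c : ℤ) (F : A → ℤ) → Σℤ xs (λ x → F x * c) ≡ Σℤ xs F * c
  Σ-*ʳ xs c F = trans (Σ-cong xs (λ x → ℤP.*-comm (F x) c)) (trans (Σ-*ˡ xs c F) (ℤP.*-comm c _))

  Σ-neg : (xs : List A) (F : A → ℤ) → Σℤ xs (λ x → - F x) ≡ - Σℤ xs F
  Σ-neg []       F = refl
  Σ-neg (x ∷ xs) F rewrite Σ-neg xs F = sym (ℤP.neg-distrib-+ (F x) _)

  Σ-const : (xs : List A) (c : ℤ) → Σℤ xs (λ _ → c) ≡ + length xs * c
  Σ-const []       c = sym (ℤP.*-zeroˡ c)
  Σ-const (x ∷ xs) c rewrite Σ-const xs c = sym (ℤP.suc-* (+ length xs) c)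

  Σ-ind : (xs : List A) (b : Bool) (F : A → ℤ) → Σℤ xs (λ x → ind b (F x)) ≡ ind b (Σℤ xs F)
  Σ-ind xs true  F = refl
  Σ-ind xs false F = Σ-zero xs

  Σ-filter : {P : A → Set} (P? : ∀ x → Dec (P x)) (xs : List A) (F : A → ℤ) →
             Σℤ (filter P? xs) F ≡ Σℤ xs (λ x → ind (does (P? x)) (F x))
  Σ-filter P? []       F = refl
  Σ-filter P? (x ∷ xs) F with does (P? x)
  ... | true  = cong (λ t → F x + t) (Σ-filter P? xs F)
  ... | false = trans (Σ-filter P? xs F) (sym (ℤP.+-identityˡ _))

  Σ-negated-filter : (xs : List A) (p : A → Bool) (F : A → ℤ) →
                     Σℤ xs (λ x → ind (p x) (- 1ℤ) * F x) ≡ - Σℤ (filter (λ x → T? (p x)) xs) F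
  Σ-negated-filter xs p F =
    trans (Σ-cong xs (λ x → trans (ind-* (p x) (- 1ℤ) (F x)) (trans (cong (ind (p x)) (ℤP.-1*i≡-i (F x))) (ind-neg (p x) (F x)))))
          (trans (Σ-neg xs (λ x → ind (p x) (F x))) (cong -_ (sym (Σ-filter (λ x → T? (p x)) xs F))))
    where ind-neg : ∀ b x → ind b (- x) ≡ - ind b x
          ind-neg true  x = refl
          ind-neg false x = refl

module _ {A B : Set} where

  Σ-map : (g : A → B) (xs : List A) (F : B → ℤ) → Σℤ (map g xs) F ≡ Σℤ xs (λ x → F (g x))
  Σ-map g []       F = refl
  Σ-map g (x ∷ xs) F = cong (λ t → F (g x) + t) (Σ-map g xs F)

  Σ-concatMap : (g : A → List B) (xs : List A) (F : B → ℤ) →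
                Σℤ (concatMap g xs) F ≡ Σℤ xs (λ x → Σℤ (g x) F)
  Σ-concatMap g []       F = refl
  Σ-concatMap g (x ∷ xs) F =
    trans (Σ-++ (g x) (concatMap g xs) F) (cong (λ t → Σℤ (g x) F + t) (Σ-concatMap g xs F))

  Σ-swap : (xs : List A) (ys : List B) (F : A → B → ℤ) →
           Σℤ xs (λ x → Σℤ ys (F x)) ≡ Σℤ ys (λ y → Σℤ xs (λ x → F x y))
  Σ-swap []       ys F = sym (Σ-zero ys)
  Σ-swap (x ∷ xs) ys F rewrite Σ-swap xs ys F = sym (Σ-+ ys (F x) (λ y → Σℤ xs (λ x' → F x' y)))

  Σ-exchange : (xs : List A) (ys : List B) (p : A → Bool) (r : B → A → Bool) (w : A → ℤ) (X : B → ℤ) →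
               Σℤ xs (λ a → ind (p a) (w a * Σℤ ys (λ b → ind (r b a) (X b))))
                 ≡ Σℤ ys (λ b → Σℤ xs (λ a → ind (p a ∧ r b a) (w a)) * X b)
  Σ-exchange xs ys p r w X =
    begin
      Σℤ xs (λ a → ind (p a) (w a * Σℤ ys (λ b → ind (r b a) (X b))))
    ≡⟨ Σ-cong xs (λ a → cong (ind (p a)) (sym (Σ-*ˡ ys (w a) (λ b → ind (r b a) (X b))))) ⟩
      Σℤ xs (λ a → ind (p a) (Σℤ ys (λ b → w a * ind (r b a) (X b))))
    ≡⟨ Σ-cong xs (λ a → sym (Σ-ind ys (p a) (λ b → w a * ind (r b a) (X b)))) ⟩
      Σℤ xs (λ a → Σℤ ys (λ b → ind (p a) (w a * ind (r b a) (X b))))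
    ≡⟨ Σ-cong xs (λ a → Σ-cong ys (λ b → regroup a b)) ⟩
      Σℤ xs (λ a → Σℤ ys (λ b → ind (p a ∧ r b a) (w a) * X b))
    ≡⟨ Σ-swap xs ys (λ a b → ind (p a ∧ r b a) (w a) * X b) ⟩
      Σℤ ys (λ b → Σℤ xs (λ a → ind (p a ∧ r b a) (w a) * X b))
    ≡⟨ Σ-cong ys (λ b → Σ-*ʳ xs (X b) (λ a → ind (p a ∧ r b a) (w a))) ⟩
      Σℤ ys (λ b → Σℤ xs (λ a → ind (p a ∧ r b a) (w a)) * X b)
    ∎
    where
      open ≡-Reasoning
      regroup : ∀ a b → ind (p a) (w a * ind (r b a) (X b)) ≡ ind (p a ∧ r b a) (w a) * X b
      regroup a b = trans (cong (ind (p a)) (*-ind (r b a) (w a) (X b)))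
                          (trans (ind-ind (p a) (r b a) (w a * X b)) (sym (ind-* (p a ∧ r b a) (w a) (X b))))

T⇔⇒≡ : ∀ {a b} → (T a → T b) → (T b → T a) → a ≡ b
T⇔⇒≡ {true}  {true}  _  _  = refl
T⇔⇒≡ {true}  {false} ab _  = ⊥-elim (ab tt)
T⇔⇒≡ {false} {true}  _  ba = ⊥-elim (ba tt)
T⇔⇒≡ {false} {false} _  _  = refl

T-∧⁻ : ∀ {a b} → T (a ∧ b) → T a × T b
T-∧⁻ = Equivalence.to T-∧

T-∧⁺ : ∀ {a b} → T a → T b → T (a ∧ b)
T-∧⁺ ta tb = Equivalence.from T-∧ (ta , tb)

≡true⇒T : ∀ {b} → b ≡ true → T b
≡true⇒T refl = tt

T⇒≡true : ∀ {b} → T b → b ≡ true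
T⇒≡true {true} _ = refl

¬T⇒≡false : ∀ {b} → ¬ T b → b ≡ false
¬T⇒≡false {true}  ¬t = ⊥-elim (¬t tt)
¬T⇒≡false {false} _  = refl

T-not⇒¬T : ∀ {b} → T (not b) → ¬ T b
T-not⇒¬T {true}  () _
T-not⇒¬T {false} _  ()

≡ᵇ-refl : ∀ n → (n ≡ᵇ n) ≡ true
≡ᵇ-refl zero    = refl
≡ᵇ-refl (suc n) = ≡ᵇ-refl n

≡ᵇ⇒≡ : ∀ {m n} → (m ≡ᵇ n) ≡ true → m ≡ n
≡ᵇ⇒≡ {m} {n} eq = ℕP.≡ᵇ⇒≡ m n (≡true⇒T eq)

≡ᵇ-false : ∀ {m n} → m ≢ n → (m ≡ᵇ n) ≡ false
≡ᵇ-false {m} {n} m≢n = ¬T⇒≡false (λ t → m≢n (ℕP.≡ᵇ⇒≡ m n t))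

≡ᵇ-sym : ∀ m n → (m ≡ᵇ n) ≡ (n ≡ᵇ m)
≡ᵇ-sym m n = T⇔⇒≡ (λ t → ℕP.≡⇒≡ᵇ n m (sym (ℕP.≡ᵇ⇒≡ m n t)))
                  (λ t → ℕP.≡⇒≡ᵇ m n (sym (ℕP.≡ᵇ⇒≡ n m t)))

-- Refinement of labellings

_⊑_ : ∀ {A B : Set} {k} → Vec A k → Vec B k → Set
x ⊑ y = ∀ i j → lookup x i ≡ lookup x j → lookup y i ≡ lookup y j

⊑-dec : ∀ {A B : Set} → DecidableEquality A → DecidableEquality B →
        ∀ {k} (x : Vec A k) (y : Vec B k) → Dec (x ⊑ y)
⊑-dec _≟A_ _≟B_ x y =
  FinP.all? λ i → FinP.all? λ j → (lookup x i ≟A lookup x j) →-dec (lookup y i ≟B lookup y j)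

⊑-refl : ∀ {A : Set} {k} (x : Vec A k) → x ⊑ x
⊑-refl x i j eq = eq

⊑-trans : ∀ {A B C : Set} {k} {x : Vec A k} {y : Vec B k} {z : Vec C k} → x ⊑ y → y ⊑ z → x ⊑ z
⊑-trans x⊑y y⊑z i j eq = y⊑z i j (x⊑y i j eq)

⊑-∷⁻ʰ : ∀ {A B : Set} {k} {a : A} {b : B} {x : Vec A k} {y : Vec B k} →
        (a ∷ x) ⊑ (b ∷ y) → ∀ j → lookup x j ≡ a → lookup y j ≡ b
⊑-∷⁻ʰ ax⊑by j eq = sym (ax⊑by zero (suc j) (sym eq))

⊑-∷⁻ : ∀ {A B : Set} {k} {a : A} {b : B} {x : Vec A k} {y : Vec B k} → (a ∷ x) ⊑ (b ∷ y) → x ⊑ y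
⊑-∷⁻ ax⊑by i j = ax⊑by (suc i) (suc j)

⊑-∷⁺ : ∀ {A B : Set} {k} {a : A} {b : B} {x : Vec A k} {y : Vec B k} →
       (∀ j → lookup x j ≡ a → lookup y j ≡ b) → x ⊑ y → (a ∷ x) ⊑ (b ∷ y)
⊑-∷⁺ head x⊑y zero    zero    eq = refl
⊑-∷⁺ head x⊑y zero    (suc j) eq = sym (head j (sym eq))
⊑-∷⁺ head x⊑y (suc i) zero    eq = head i eq
⊑-∷⁺ head x⊑y (suc i) (suc j) eq = x⊑y i j eq

⊑-entry? : ∀ {k} (x y : Vec ℕ k) i j → Dec (lookup x i ≡ lookup x j → lookup y i ≡ lookup y j)
⊑-entry? x y i j = (lookup x i ℕP.≟ lookup x j) →-dec (lookup y i ℕP.≟ lookup y j)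

⋢⇒witness : ∀ {k} (x y : Vec ℕ k) → ¬ x ⊑ y →
            ∃ λ i → ∃ λ j → lookup x i ≡ lookup x j × lookup y i ≢ lookup y j
⋢⇒witness {k} x y x⋢y with FinP.¬∀⟶∃¬ k _ (λ i → FinP.all? (⊑-entry? x y i)) x⋢y
... | i , ¬row with FinP.¬∀⟶∃¬ k _ (⊑-entry? x y i) ¬row
... | j , ¬entry with lookup x i ℕP.≟ lookup x j | lookup y i ℕP.≟ lookup y j
...   | yes ex | yes ey = ⊥-elim (¬entry (λ _ → ey))
...   | no ¬ex | _      = ⊥-elim (¬entry (λ ex → ⊥-elim (¬ex ex)))
...   | yes ex | no ¬ey = i , j , ex , ¬ey

≤ᵖ⇒⊑ : ∀ {n} (π σ : Labelling n) → T (π ≤ᵖ σ) → π ⊑ σ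
≤ᵖ⇒⊑ {n} π σ π≤σ i j eq = ℕP.≡ᵇ⇒≡ _ _ (subst T (if-true (ℕP.≡⇒≡ᵇ _ _ eq)) entry)
  where
    entry : T (if lookup π i ≡ᵇ lookup π j then lookup σ i ≡ᵇ lookup σ j else true)
    entry = AllP.tabulate⁻ (AllP.all⁺ _ _ (AllP.tabulate⁻ (AllP.all⁺ _ _ π≤σ) i)) j
    if-true : ∀ {b c} → T b → (if b then c else true) ≡ c
    if-true {true} _ = refl

⊑⇒≤ᵖ : ∀ {n} (π σ : Labelling n) → π ⊑ σ → T (π ≤ᵖ σ)
⊑⇒≤ᵖ π σ π⊑σ = AllP.all⁻ _ (AllP.tabulate⁺ λ i → AllP.all⁻ _ (AllP.tabulate⁺ λ j → entry i j))
  where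
    entry : ∀ i j → T (if lookup π i ≡ᵇ lookup π j then lookup σ i ≡ᵇ lookup σ j else true)
    entry i j with lookup π i ≡ᵇ lookup π j in eq
    ... | true  = ℕP.≡⇒≡ᵇ _ _ (π⊑σ i j (≡ᵇ⇒≡ eq))
    ... | false = tt

-- Counting blocks

none : ℕ → Bool
none _ = false

add : (ℕ → Bool) → ℕ → ℕ → Bool
add D x y = D y ∨ (y ≡ᵇ x)

elemᵇ : ℕ → List ℕ → Bool
elemᵇ a []       = false
elemᵇ a (x ∷ xs) = (x ≡ᵇ a) ∨ elemᵇ a xs

countNew : (ℕ → Bool) → List ℕ → ℕ
countNew D []       = 0
countNew D (x ∷ xs) = if D x then countNew D xs else suc (countNew (add D x) xs)

countNew-cong : ∀ {D E} → (∀ y → D y ≡ E y) → ∀ xs → countNew D xs ≡ countNew E xs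
countNew-cong D≗E []       = refl
countNew-cong {D} {E} D≗E (x ∷ xs) rewrite D≗E x with E x
... | true  = countNew-cong D≗E xs
... | false = cong suc (countNew-cong (λ y → cong (_∨ (y ≡ᵇ x)) (D≗E y)) xs)

countNew-≤ : ∀ D xs → countNew D xs ≤ length xs
countNew-≤ D []       = z≤n
countNew-≤ D (x ∷ xs) with D x
... | true  = ℕP.m≤n⇒m≤1+n (countNew-≤ D xs)
... | false = s≤s (countNew-≤ (add D x) xs)

countNew-add : ∀ D x xs → D x ≡ false →
               countNew (add D x) xs ℕ.+ (if elemᵇ x xs then 1 else 0) ≡ countNew D xs
countNew-add D x []       Dx≡false = refl
countNew-add D x (y ∷ xs) Dx≡false with D y in Dy | y ≡ᵇ x in y≡ᵇx
... | true  | true  with () ← trans (sym Dx≡false) (trans (cong D (sym (≡ᵇ⇒≡ {y} {x} y≡ᵇx))) Dy)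
... | true  | false = countNew-add D x xs Dx≡false
... | false | true with refl ← ≡ᵇ⇒≡ {y} {x} y≡ᵇx = ℕP.+-comm (countNew (add D y) xs) 1
... | false | false =
  cong suc (trans (cong (ℕ._+ (if elemᵇ x xs then 1 else 0)) (countNew-cong add-comm xs))
                  (countNew-add (add D y) x xs x∉Dy))
  where
    x∉Dy : add D y x ≡ false
    x∉Dy rewrite Dx≡false | ≡ᵇ-sym x y | y≡ᵇx = refl
    add-comm : ∀ z → add (add D x) y z ≡ add (add D y) x z
    add-comm z with D z | z ≡ᵇ x | z ≡ᵇ y
    ... | true  | _     | _ = refl
    ... | false | true  | c = sym (∨-zeroʳ c)
    ... | false | false | c = sym (∨-identityʳ c)

countOutside : (ℕ → Bool) → List ℕ → ℕ
countOutside D []       = 0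
countOutside D (y ∷ ys) = if D y then countOutside D ys else suc (countOutside D ys)

countOutside-cong : ∀ {D E} → (∀ y → D y ≡ E y) → ∀ xs → countOutside D xs ≡ countOutside E xs
countOutside-cong D≗E []       = refl
countOutside-cong {D} {E} D≗E (x ∷ xs) rewrite D≗E x with E x
... | true  = countOutside-cong D≗E xs
... | false = cong suc (countOutside-cong D≗E xs)

countOutside-filter : ∀ {P : ℕ → Set} (P? : ∀ y → Dec (P y)) D xs →
                      countOutside D (filter P? xs) ≡ countOutside (λ y → D y ∨ not (does (P? y))) xs
countOutside-filter P? D []       = refl
countOutside-filter P? D (x ∷ xs) with does (P? x)
countOutside-filter P? D (x ∷ xs) | true with D x
... | true  = countOutside-filter P? D xs
... | false = cong suc (countOutside-filter P? D xs)
countOutside-filter P? D (x ∷ xs) | false with D x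
... | true  = countOutside-filter P? D xs
... | false = countOutside-filter P? D xs

length≡countOutside : ∀ xs → length xs ≡ countOutside none xs
length≡countOutside []       = refl
length≡countOutside (x ∷ xs) = cong suc (length≡countOutside xs)

dedup : List ℕ → List ℕ
dedup = deduplicateᵇ _≡ᵇ_

countOutside-dedup : ∀ D xs → countOutside D (dedup xs) ≡ countNew D xs
countOutside-dedup D []       = refl
countOutside-dedup D (x ∷ xs) with D x in Dx
... | true  = trans (countOutside-filter _ D (dedup xs))
                    (trans (countOutside-cong D∨≡x≗D (dedup xs)) (countOutside-dedup D xs))
  where
    D∨≡x≗D : ∀ y → (D y ∨ not (not (x ≡ᵇ y))) ≡ D y
    D∨≡x≗D y with x ≡ᵇ y in x≡ᵇy
    ... | true with refl ← ≡ᵇ⇒≡ {x} {y} x≡ᵇy = trans (∨-zeroʳ (D x)) (sym Dx)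
    ... | false = ∨-identityʳ (D y)
... | false = cong suc (trans (countOutside-filter _ D (dedup xs))
                              (trans (countOutside-cong D∨≡x≗add (dedup xs)) (countOutside-dedup (add D x) xs)))
  where
    D∨≡x≗add : ∀ y → (D y ∨ not (not (x ≡ᵇ y))) ≡ add D x y
    D∨≡x≗add y rewrite not-involutive (x ≡ᵇ y) | ≡ᵇ-sym x y = refl

blockCount : ∀ {k} → Vec ℕ k → ℕ
blockCount v = countNew none (toList v)

nBlocks≡blockCount : ∀ {k} (v : Vec ℕ k) → nBlocks v ≡ blockCount v
nBlocks≡blockCount v = trans (length≡countOutside (dedup (toList v))) (countOutside-dedup none (toList v))

blockCount-≤ : ∀ {k} (v : Vec ℕ k) → blockCount v ≤ k
blockCount-≤ v = subst (blockCount v ≤_) (VecP.length-toList v) (countNew-≤ none (toList v))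

blockCount-∷ : ∀ {k} x (z : Vec ℕ k) →
               blockCount (x ∷ z) ≡ (if elemᵇ x (toList z) then blockCount z else suc (blockCount z))
blockCount-∷ x z = lemma (elemᵇ x (toList z)) (countNew-add none x (toList z) refl)
  where
    lemma : ∀ b → countNew (add none x) (toList z) ℕ.+ (if b then 1 else 0) ≡ blockCount z →
            suc (countNew (add none x) (toList z)) ≡ (if b then blockCount z else suc (blockCount z))
    lemma true  eq = trans (ℕP.+-comm 1 _) eq
    lemma false eq = cong suc (trans (sym (ℕP.+-identityʳ _)) eq)

elemᵇ⇒lookup : ∀ {k} a (z : Vec ℕ k) → elemᵇ a (toList z) ≡ true → ∃ λ j → lookup z j ≡ a
elemᵇ⇒lookup a (x ∷ z) a∈ with x ≡ᵇ a in x≡ᵇa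
... | true  = zero , ≡ᵇ⇒≡ x≡ᵇa
... | false = let j , eq = elemᵇ⇒lookup a z a∈ in suc j , eq

lookup⇒elemᵇ : ∀ {k} a (z : Vec ℕ k) j → lookup z j ≡ a → elemᵇ a (toList z) ≡ true
lookup⇒elemᵇ a (x ∷ z) zero    refl rewrite ≡ᵇ-refl x = refl
lookup⇒elemᵇ a (x ∷ z) (suc j) eq with x ≡ᵇ a
... | true  = refl
... | false = lookup⇒elemᵇ a z j eq

elemᵇ-⊑ : ∀ {k} {a b} {z y : Vec ℕ k} → (a ∷ z) ⊑ (b ∷ y) →
          elemᵇ a (toList z) ≡ true → elemᵇ b (toList y) ≡ true
elemᵇ-⊑ {a = a} {b} {z} {y} az⊑by a∈z =
  let j , zj≡a = elemᵇ⇒lookup a z a∈z in lookup⇒elemᵇ b y j (⊑-∷⁻ʰ az⊑by j zj≡a)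

blockCount-≤-∷ : ∀ {k} x (z : Vec ℕ k) → blockCount z ≤ blockCount (x ∷ z)
blockCount-≤-∷ x z rewrite blockCount-∷ x z with elemᵇ x (toList z)
... | true  = ℕP.≤-refl
... | false = ℕP.n≤1+n _

blockCount-∷-mono : ∀ {k} {a b} {z y : Vec ℕ k} → (a ∷ z) ⊑ (b ∷ y) →
                    blockCount y ≤ blockCount z → blockCount (b ∷ y) ≤ blockCount (a ∷ z)
blockCount-∷-mono {a = a} {b} {z} {y} az⊑by y≤z
  rewrite blockCount-∷ a z | blockCount-∷ b y
  with elemᵇ b (toList y) in b∈y | elemᵇ a (toList z) in a∈z
... | true  | true  = y≤z
... | true  | false = ℕP.m≤n⇒m≤1+n y≤z
... | false | true  with () ← trans (sym (elemᵇ-⊑ az⊑by a∈z)) b∈y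
... | false | false = s≤s y≤z

blockCount-∷-strict : ∀ {k} {a b} {z y : Vec ℕ k} → (a ∷ z) ⊑ (b ∷ y) →
                      blockCount y < blockCount z → blockCount (b ∷ y) < blockCount (a ∷ z)
blockCount-∷-strict {a = a} {b} {z} {y} az⊑by y<z
  rewrite blockCount-∷ b y with elemᵇ b (toList y) in b∈y
... | true  = ℕP.<-≤-trans y<z (blockCount-≤-∷ a z)
... | false rewrite blockCount-∷ a z with elemᵇ a (toList z) in a∈z
...   | true  with () ← trans (sym (elemᵇ-⊑ az⊑by a∈z)) b∈y
...   | false = s≤s y<z

blockCount-mono : ∀ {k} (z y : Vec ℕ k) → z ⊑ y → blockCount y ≤ blockCount z
blockCount-mono []      []      _    = z≤n
blockCount-mono (a ∷ z) (b ∷ y) z⊑y = blockCount-∷-mono z⊑y (blockCount-mono z y (⊑-∷⁻ z⊑y))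

blockCount-strict : ∀ {k} (z y : Vec ℕ k) → z ⊑ y →
                    ∀ i j → lookup y i ≡ lookup y j → lookup z i ≢ lookup z j → blockCount y < blockCount z
blockCount-strict-head : ∀ {k} a b (z y : Vec ℕ k) → (a ∷ z) ⊑ (b ∷ y) →
                         ∀ j → b ≡ lookup y j → a ≢ lookup z j → blockCount (b ∷ y) < blockCount (a ∷ z)

blockCount-strict (a ∷ z) (b ∷ y) z⊑y zero    zero    _  zi≢zj = ⊥-elim (zi≢zj refl)
blockCount-strict (a ∷ z) (b ∷ y) z⊑y zero    (suc j) yi≡yj zi≢zj = blockCount-strict-head a b z y z⊑y j yi≡yj zi≢zj
blockCount-strict (a ∷ z) (b ∷ y) z⊑y (suc i) zero    yi≡yj zi≢zj =
  blockCount-strict-head a b z y z⊑y i (sym yi≡yj) (λ eq → zi≢zj (sym eq))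
blockCount-strict (a ∷ z) (b ∷ y) z⊑y (suc i) (suc j) yi≡yj zi≢zj =
  blockCount-∷-strict z⊑y (blockCount-strict z y (⊑-∷⁻ z⊑y) i j yi≡yj zi≢zj)

-- b already occurs in y; if a occurs in z at some k, the pair (k, j) separates z but not y.
blockCount-strict-head a b z y az⊑by j b≡yj a≢zj
  rewrite blockCount-∷ b y | lookup⇒elemᵇ b y j (sym b≡yj)
  with elemᵇ a (toList z) in a∈z
... | true  = let k , zk≡a = elemᵇ⇒lookup a z a∈z in
  ℕP.<-≤-trans (blockCount-strict z y (⊑-∷⁻ az⊑by) k j (trans (⊑-∷⁻ʰ az⊑by k zk≡a) b≡yj)
                                   (λ eq → a≢zj (trans (sym zk≡a) eq)))
               (blockCount-≤-∷ a z)
... | false rewrite blockCount-∷ a z | a∈z = s≤s (blockCount-mono z y (⊑-∷⁻ az⊑by))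

-- Restricted growth strings

grow : ℕ → ℕ → ℕ
grow m ℓ = if ℓ ≡ᵇ m then suc m else m

grow-< : ∀ {m ℓ} → ℓ < m → grow m ℓ ≡ m
grow-< {m} {ℓ} ℓ<m = cong (λ b → if b then suc m else m) (≡ᵇ-false (ℕP.<⇒≢ ℓ<m))

grow-≡ : ∀ m → grow m m ≡ suc m
grow-≡ m = cong (λ b → if b then suc m else m) (≡ᵇ-refl m)

IsRgs : ∀ {k} → ℕ → Vec ℕ k → Set
IsRgs m []      = ⊤
IsRgs m (ℓ ∷ v) = ℓ ≤ m × IsRgs (grow m ℓ) v

∈rgs⇒IsRgs : ∀ {k} m (v : Vec ℕ k) → v ∈ rgs k m → IsRgs m v
∈rgs⇒IsRgs {zero}  m [] _ = tt
∈rgs⇒IsRgs {suc k} m v v∈ with find (∈-concatMap⁻ (λ ℓ → map (ℓ ∷_) (rgs k (grow m ℓ))) {xs = upTo (suc m)} v∈)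
... | ℓ , ℓ∈ , v∈ℓ with ∈-map⁻ (ℓ ∷_) v∈ℓ
... | z , z∈ , refl = ℕP.<⇒≤pred (∈-upTo⁻ ℓ∈) , ∈rgs⇒IsRgs (grow m ℓ) z z∈

IsRgs⇒∈rgs : ∀ {k} m (v : Vec ℕ k) → IsRgs m v → v ∈ rgs k m
IsRgs⇒∈rgs {zero}  m [] _ = here refl
IsRgs⇒∈rgs {suc k} m (ℓ ∷ v) (ℓ≤m , rest) =
  ∈-concatMap⁺ (λ ℓ → map (ℓ ∷_) (rgs k (grow m ℓ))) {xs = upTo (suc m)}
    (lose (∈-upTo⁺ (s≤s ℓ≤m)) (∈-map⁺ (ℓ ∷_) (IsRgs⇒∈rgs (grow m ℓ) v rest)))

Σ-rgs-∷ : ∀ k m (F : Vec ℕ (suc k) → ℤ) →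
          Σℤ (rgs (suc k) m) F ≡ Σℤ (upTo (suc m)) (λ ℓ → Σℤ (rgs k (grow m ℓ)) (λ v → F (ℓ ∷ v)))
Σ-rgs-∷ k m F = trans (Σ-concatMap (λ ℓ → map (ℓ ∷_) (rgs k (grow m ℓ))) (upTo (suc m)) F)
                      (Σ-cong (upTo (suc m)) (λ ℓ → Σ-map (ℓ ∷_) (rgs k (grow m ℓ)) F))

Agrees : ∀ {k} → ℕ → Vec ℕ k → Vec ℕ k → Set
Agrees m v w = ∀ i → lookup v i < m → lookup w i ≡ lookup v i

agrees-∷ : ∀ {k} {m ℓ} {v w : Vec ℕ k} → (ℓ ∷ v) ⊑ (ℓ ∷ w) →
           Agrees m (ℓ ∷ v) (ℓ ∷ w) → Agrees (grow m ℓ) v w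
agrees-∷ {m = m} {ℓ} ℓv⊑ℓw agree i vi<m′ with ℓ ≡ᵇ m in ℓ≡ᵇm
... | false = agree (suc i) vi<m′
... | true with ℕP.m≤n⇒m<n∨m≡n (ℕP.≤-pred vi<m′)
...   | inj₁ vi<m = agree (suc i) vi<m
...   | inj₂ vi≡m =
  trans (ℓv⊑ℓw (suc i) zero (trans vi≡m (sym (≡ᵇ⇒≡ ℓ≡ᵇm)))) (trans (≡ᵇ⇒≡ ℓ≡ᵇm) (sym vi≡m))

first-label-≡ : ∀ {m ℓ ℓ′} → ℓ ≤ m → ℓ′ ≤ m → (ℓ < m → ℓ′ ≡ ℓ) → (ℓ′ < m → ℓ ≡ ℓ′) → ℓ ≡ ℓ′
first-label-≡ ℓ≤m ℓ′≤m agree agree′ with ℕP.m≤n⇒m<n∨m≡n ℓ≤m | ℕP.m≤n⇒m<n∨m≡n ℓ′≤m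
... | inj₁ ℓ<m | _          = sym (agree ℓ<m)
... | inj₂ _   | inj₁ ℓ′<m  = agree′ ℓ′<m
... | inj₂ ℓ≡m | inj₂ ℓ′≡m  = trans ℓ≡m (sym ℓ′≡m)

IsRgs-unique : ∀ {k} m (v w : Vec ℕ k) → IsRgs m v → IsRgs m w → v ⊑ w → w ⊑ v →
               Agrees m v w → Agrees m w v → v ≡ w
IsRgs-unique m []      []       _ _ _ _ _ _ = refl
IsRgs-unique m (ℓ ∷ v) (ℓ′ ∷ w) (ℓ≤m , rgs-v) (ℓ′≤m , rgs-w) v⊑w w⊑v agree agree′
  with first-label-≡ ℓ≤m ℓ′≤m (agree zero) (agree′ zero)
... | refl = cong (ℓ ∷_) (IsRgs-unique (grow m ℓ) v w rgs-v rgs-w (⊑-∷⁻ v⊑w) (⊑-∷⁻ w⊑v)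
                                       (agrees-∷ v⊑w agree) (agrees-∷ w⊑v agree′))

IsRgs₀-unique : ∀ {k} (v w : Vec ℕ k) → IsRgs 0 v → IsRgs 0 w → v ⊑ w → w ⊑ v → v ≡ w
IsRgs₀-unique v w rgs-v rgs-w v⊑w w⊑v = IsRgs-unique 0 v w rgs-v rgs-w v⊑w w⊑v (λ _ ()) (λ _ ())

Σ-upTo-≡ᵇ-absent : ∀ N ℓ₀ → N ≤ ℓ₀ → (H : ℕ → ℤ) → Σℤ (upTo N) (λ ℓ → ind (ℓ ≡ᵇ ℓ₀) (H ℓ)) ≡ 0ℤ
Σ-upTo-≡ᵇ-absent N ℓ₀ N≤ℓ₀ H =
  trans (Σ-cong-∈ (upTo N) λ ℓ ℓ∈ →
           cong (λ b → ind b (H ℓ)) (≡ᵇ-false (ℕP.<⇒≢ (ℕP.<-≤-trans (∈-upTo⁻ ℓ∈) N≤ℓ₀))))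
        (Σ-zero (upTo N))

Σ-upTo-suc : ∀ m (H : ℕ → ℤ) → Σℤ (upTo (suc m)) H ≡ Σℤ (upTo m) H + H m
Σ-upTo-suc m H =
  trans (cong (λ xs → Σℤ xs H) (sym (ListP.upTo-∷ʳ m)))
        (trans (Σ-++ (upTo m) (m ∷ []) H) (cong (λ x → Σℤ (upTo m) H + x) (ℤP.+-identityʳ (H m))))

Σ-upTo-split : ∀ m (H : ℕ → ℤ) {a b} → (∀ ℓ → ℓ < m → H ℓ ≡ a) → H m ≡ b → Σℤ (upTo (suc m)) H ≡ + m * a + b
Σ-upTo-split m H {a} {b} H<m Hm =
  trans (Σ-upTo-suc m H)
        (cong₂ _+_ (trans (Σ-cong-∈ (upTo m) (λ ℓ ℓ∈ → H<m ℓ (∈-upTo⁻ ℓ∈)))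
                          (trans (Σ-const (upTo m) a) (cong (λ q → + q * a) (ListP.length-upTo m))))
                   Hm)

Σ-upTo-≡ᵇ : ∀ N ℓ₀ → ℓ₀ < N → (H : ℕ → ℤ) → Σℤ (upTo N) (λ ℓ → ind (ℓ ≡ᵇ ℓ₀) (H ℓ)) ≡ H ℓ₀
Σ-upTo-≡ᵇ (suc N) ℓ₀ ℓ₀<1+N H rewrite Σ-upTo-suc N (λ ℓ → ind (ℓ ≡ᵇ ℓ₀) (H ℓ))
  with ℕP.m≤n⇒m<n∨m≡n (ℕP.≤-pred ℓ₀<1+N)
... | inj₁ ℓ₀<N rewrite Σ-upTo-≡ᵇ N ℓ₀ ℓ₀<N H | ≡ᵇ-false (λ N≡ℓ₀ → ℕP.<⇒≢ ℓ₀<N (sym N≡ℓ₀)) =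
  ℤP.+-identityʳ _
... | inj₂ refl rewrite Σ-upTo-≡ᵇ-absent N N ℕP.≤-refl H | ≡ᵇ-refl N = ℤP.+-identityˡ _

_==ᵛ_ : ∀ {k} → Vec ℕ k → Vec ℕ k → Bool
[]       ==ᵛ []       = true
(x ∷ xs) ==ᵛ (y ∷ ys) = (x ≡ᵇ y) ∧ (xs ==ᵛ ys)

==ᵛ⇒≡ : ∀ {k} (v w : Vec ℕ k) → T (v ==ᵛ w) → v ≡ w
==ᵛ⇒≡ []       []       _  = refl
==ᵛ⇒≡ (x ∷ xs) (y ∷ ys) eq = let x≡ᵇy , xs==ys = T-∧⁻ {x ≡ᵇ y} eq in
  cong₂ _∷_ (ℕP.≡ᵇ⇒≡ x y x≡ᵇy) (==ᵛ⇒≡ xs ys xs==ys)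

==ᵛ-refl : ∀ {k} (v : Vec ℕ k) → (v ==ᵛ v) ≡ true
==ᵛ-refl []       = refl
==ᵛ-refl (x ∷ xs) rewrite ≡ᵇ-refl x = ==ᵛ-refl xs

Σ-rgs-==ᵛ : ∀ k m (y : Vec ℕ k) → IsRgs m y → (F : Vec ℕ k → ℤ) →
            Σℤ (rgs k m) (λ z → ind (z ==ᵛ y) (F z)) ≡ F y
Σ-rgs-==ᵛ zero    m []        _ F = ℤP.+-identityʳ _
Σ-rgs-==ᵛ (suc k) m (ℓ₀ ∷ y) (ℓ₀≤m , rgs-y) F =
  begin
    Σℤ (rgs (suc k) m) (λ z → ind (z ==ᵛ (ℓ₀ ∷ y)) (F z))
  ≡⟨ Σ-rgs-∷ k m (λ z → ind (z ==ᵛ (ℓ₀ ∷ y)) (F z)) ⟩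
    Σℤ (upTo (suc m)) (λ ℓ → Σℤ (rgs k (grow m ℓ)) (λ z → ind ((ℓ ≡ᵇ ℓ₀) ∧ (z ==ᵛ y)) (F (ℓ ∷ z))))
  ≡⟨ Σ-cong (upTo (suc m)) split-head ⟩
    Σℤ (upTo (suc m)) (λ ℓ → ind (ℓ ≡ᵇ ℓ₀) (tailSum ℓ))
  ≡⟨ Σ-upTo-≡ᵇ (suc m) ℓ₀ (s≤s ℓ₀≤m) tailSum ⟩
    tailSum ℓ₀
  ≡⟨ Σ-rgs-==ᵛ k (grow m ℓ₀) y rgs-y (λ z → F (ℓ₀ ∷ z)) ⟩
    F (ℓ₀ ∷ y)
  ∎
  where
    open ≡-Reasoning
    tailSum : ℕ → ℤ
    tailSum ℓ = Σℤ (rgs k (grow m ℓ)) (λ z → ind (z ==ᵛ y) (F (ℓ ∷ z)))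
    split-head : ∀ ℓ → Σℤ (rgs k (grow m ℓ)) (λ z → ind ((ℓ ≡ᵇ ℓ₀) ∧ (z ==ᵛ y)) (F (ℓ ∷ z)))
                         ≡ ind (ℓ ≡ᵇ ℓ₀) (tailSum ℓ)
    split-head ℓ = trans (Σ-cong (rgs k (grow m ℓ)) (λ z → sym (ind-ind (ℓ ≡ᵇ ℓ₀) (z ==ᵛ y) (F (ℓ ∷ z)))))
                         (Σ-ind (rgs k (grow m ℓ)) (ℓ ≡ᵇ ℓ₀) _)

-- The restricted growth string of an arbitrary labelling

module Canonical {A : Set} (_≟_ : DecidableEquality A) where

  elem : A → List A → Bool
  elem x []       = false
  elem x (y ∷ ys) = does (x ≟ y) ∨ elem x ys

  index : A → List A → ℕ
  index x []       = 0
  index x (y ∷ ys) = if does (x ≟ y) then 0 else suc (index x ys)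

  -- S lists the labels already met, in order of first occurrence.
  canonFrom : ∀ {k} → List A → Vec A k → Vec ℕ k
  canonFrom S []       = []
  canonFrom S (x ∷ xs) = index x S ∷ canonFrom (if elem x S then S else S ++ x ∷ []) xs

  canon : ∀ {k} → Vec A k → Vec ℕ k
  canon = canonFrom []

  index-< : ∀ x S → elem x S ≡ true → index x S < length S
  index-< x (y ∷ S) x∈ with x ≟ y
  ... | yes _ = s≤s z≤n
  ... | no  _ = s≤s (index-< x S x∈)

  index-∉ : ∀ x S → elem x S ≡ false → index x S ≡ length S
  index-∉ x []      _  = refl
  index-∉ x (y ∷ S) x∉ with x ≟ y
  ... | no _ = cong suc (index-∉ x S x∉)

  index-++-∈ : ∀ x S U → elem x S ≡ true → index x (S ++ U) ≡ index x S
  index-++-∈ x (y ∷ S) U x∈ with x ≟ y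
  ... | yes _ = refl
  ... | no  _ = cong suc (index-++-∈ x S U x∈)

  index-++-∉ : ∀ x S U → elem x S ≡ false → index x (S ++ U) ≡ length S ℕ.+ index x U
  index-++-∉ x []      U _  = refl
  index-++-∉ x (y ∷ S) U x∉ with x ≟ y
  ... | no _ = cong suc (index-++-∉ x S U x∉)

  elem-++ˡ : ∀ x S U → elem x S ≡ true → elem x (S ++ U) ≡ true
  elem-++ˡ x (y ∷ S) U x∈ with does (x ≟ y)
  ... | true  = refl
  ... | false = elem-++ˡ x S U x∈

  elem-++ʳ : ∀ x S U → elem x U ≡ true → elem x (S ++ U) ≡ true
  elem-++ʳ x []      U x∈ = x∈
  elem-++ʳ x (y ∷ S) U x∈ with does (x ≟ y)
  ... | true  = refl
  ... | false = elem-++ʳ x S U x∈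

  elem-here : ∀ x U → elem x (x ∷ U) ≡ true
  elem-here x U with x ≟ x
  ... | yes _ = refl
  ... | no  x≢x = ⊥-elim (x≢x refl)

  index-here : ∀ x U → index x (x ∷ U) ≡ 0
  index-here x U with x ≟ x
  ... | yes _ = refl
  ... | no  x≢x = ⊥-elim (x≢x refl)

  index-injective : ∀ x y U → elem x U ≡ true → elem y U ≡ true → index x U ≡ index y U → x ≡ y
  index-injective x y (u ∷ U) x∈ y∈ eq with x ≟ u | y ≟ u
  ... | yes x≡u | yes y≡u = trans x≡u (sym y≡u)
  ... | no  _   | no  _   = index-injective x y U x∈ y∈ (ℕP.suc-injective eq)

  canonFrom-IsRgs : ∀ {k} S (xs : Vec A k) → IsRgs (length S) (canonFrom S xs)
  canonFrom-IsRgs S []       = tt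
  canonFrom-IsRgs S (x ∷ xs) with elem x S in x∈S
  ... | true  = ℕP.<⇒≤ (index-< x S x∈S) ,
                subst (λ m → IsRgs m (canonFrom S xs)) (sym (grow-< (index-< x S x∈S))) (canonFrom-IsRgs S xs)
  ... | false = ℕP.≤-reflexive (index-∉ x S x∈S) ,
                subst (λ m → IsRgs m (canonFrom (S ++ x ∷ []) xs)) length-grows (canonFrom-IsRgs (S ++ x ∷ []) xs)
    where
      length-grows : length (S ++ x ∷ []) ≡ grow (length S) (index x S)
      length-grows rewrite index-∉ x S x∈S | grow-≡ (length S) =
        trans (ListP.length-++ S) (ℕP.+-comm (length S) 1)

  canonFrom-index : ∀ {k} S (xs : Vec A k) → ∃ λ U →
    (∀ i → lookup (canonFrom S xs) i ≡ index (lookup xs i) (S ++ U)) × (∀ i → elem (lookup xs i) (S ++ U) ≡ true)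
  canonFrom-index S [] = [] , (λ ()) , (λ ())
  canonFrom-index S (x ∷ xs) with elem x S in x∈S
  ... | true = let U , idx , mem = canonFrom-index S xs in
    U , (λ { zero → sym (index-++-∈ x S U x∈S) ; (suc i) → idx i })
      , (λ { zero → elem-++ˡ x S U x∈S ; (suc i) → mem i })
  ... | false = let U , idx , mem = canonFrom-index (S ++ x ∷ []) xs in
    x ∷ U , (λ { zero → trans (index-∉ x S x∈S)
                              (sym (trans (index-++-∉ x S (x ∷ U) x∈S)
                                          (trans (cong (length S ℕ.+_) (index-here x U)) (ℕP.+-identityʳ _))))
               ; (suc i) → trans (idx i) (cong (index (lookup xs i)) (ListP.++-assoc S (x ∷ []) U)) })
          , (λ { zero → elem-++ʳ x S (x ∷ U) (elem-here x U)
               ; (suc i) → subst (λ l → elem (lookup xs i) l ≡ true) (ListP.++-assoc S (x ∷ []) U) (mem i) })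

  canon-IsRgs : ∀ {k} (xs : Vec A k) → IsRgs 0 (canon xs)
  canon-IsRgs = canonFrom-IsRgs []

  ⊑-canon : ∀ {k} (xs : Vec A k) → xs ⊑ canon xs
  ⊑-canon xs i j eq = let U , idx , _ = canonFrom-index [] xs in
    trans (idx i) (trans (cong (λ a → index a U) eq) (sym (idx j)))

  canon-⊑ : ∀ {k} (xs : Vec A k) → canon xs ⊑ xs
  canon-⊑ xs i j eq = let U , idx , mem = canonFrom-index [] xs in
    index-injective _ _ U (mem i) (mem j) (trans (sym (idx i)) (trans eq (idx j)))

-- The Möbius function of 𝒫(n) from the bottom

lookup-bot : ∀ {n} (i : Fin n) → lookup (bot n) i ≡ toℕ i
lookup-bot i = VecP.lookup∘tabulate toℕ i

bot-⊑ : ∀ {n} {B : Set} (y : Vec B n) → bot n ⊑ y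
bot-⊑ y i j eq with FinP.toℕ-injective (trans (sym (lookup-bot i)) (trans eq (lookup-bot j)))
... | refl = refl

bot-≤ᵖ : ∀ {n} (y : Labelling n) → (bot n ≤ᵖ y) ≡ true
bot-≤ᵖ {n} y = T⇒≡true (⊑⇒≤ᵖ (bot n) y (bot-⊑ y))

module Möbius (n : ℕ) where

  L : List (Labelling n)
  L = Partitions n

  -- The recursion depth of mobiusF at z is bounded by the rank n - |z| of z.
  rank : Labelling n → ℕ
  rank z = n ∸ blockCount z

  rank-≤ : ∀ z → rank z ≤ n
  rank-≤ z = ℕP.m∸n≤m n (blockCount z)

  rank-< : ∀ w z → T (w ≤ᵖ z) → T (not (z ≤ᵖ w)) → rank w < rank z
  rank-< w z w≤z z≰w with ⊑-dec ℕP._≟_ ℕP._≟_ z w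
  ... | yes z⊑w = ⊥-elim (T-not⇒¬T z≰w (⊑⇒≤ᵖ z w z⊑w))
  ... | no  z⋢w = let i , j , zi≡zj , wi≢wj = ⋢⇒witness z w z⋢w in
    ℕP.∸-monoʳ-< (blockCount-strict w z (≤ᵖ⇒⊑ w z w≤z) i j zi≡zj wi≢wj) (blockCount-≤ w)

  strictlyBetween : Labelling n → Labelling n → Labelling n → Bool
  strictlyBetween x y z = (x ≤ᵖ z) ∧ ((z ≤ᵖ y) ∧ not (y ≤ᵖ z))

  rank-<-between : ∀ y z → T (strictlyBetween (bot n) y z) → rank z < rank y
  rank-<-between y z between =
    let z≤y , y≰z = T-∧⁻ {z ≤ᵖ y} (proj₂ (T-∧⁻ {bot n ≤ᵖ z} between)) in rank-< z y z≤y y≰z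

  mobiusStep : (Labelling n → ℤ) → Labelling n → Labelling n → ℤ
  mobiusStep h x y = if x ≈ᵖ y then + 1
                     else if x ≤ᵖ y then - Σℤ (filter (λ z → T? (strictlyBetween x y z)) L) h
                     else + 0

  mobiusStep-cong : ∀ h h′ x y → (∀ z → z ∈ filter (λ z → T? (strictlyBetween x y z)) L → h z ≡ h′ z) →
                    mobiusStep h x y ≡ mobiusStep h′ x y
  mobiusStep-cong h h′ x y h≗h′ with x ≈ᵖ y
  ... | true  = refl
  ... | false with x ≤ᵖ y
  ...   | true  = cong -_ (Σ-cong-∈ _ h≗h′)
  ...   | false = refl

  mobiusF-fuel : ∀ f f′ z → rank z < f → rank z < f′ → mobiusF f (bot n) z ≡ mobiusF f′ (bot n) z
  mobiusF-fuel (suc f) (suc f′) z z<f z<f′ =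
    mobiusStep-cong (mobiusF f (bot n)) (mobiusF f′ (bot n)) (bot n) z λ w w∈ →
      let w<z = rank-<-between z w (proj₂ (∈-filter⁻ (λ w → T? (strictlyBetween (bot n) z w)) {xs = L} w∈)) in
      mobiusF-fuel f f′ w (ℕP.<-≤-trans w<z (ℕP.≤-pred z<f)) (ℕP.<-≤-trans w<z (ℕP.≤-pred z<f′))

  μ : Labelling n → ℤ
  μ = mobius (bot n)

  μ-bot : ∀ y → (y ≤ᵖ bot n) ≡ true → μ y ≡ 1ℤ
  μ-bot y y≤bot rewrite bot-≤ᵖ y | y≤bot = refl

  μ-rec : ∀ y → (y ≤ᵖ bot n) ≡ false → μ y ≡ - Σℤ L (λ z → ind (strictlyBetween (bot n) y z) (μ z))
  μ-rec y y≰bot rewrite bot-≤ᵖ y | y≰bot =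
    cong -_ (trans (Σ-filter (λ z → T? (strictlyBetween (bot n) y z)) L (mobiusF n (bot n))) (Σ-cong L fuel))
    where
      fuel : ∀ z → ind (strictlyBetween (bot n) y z) (mobiusF n (bot n) z) ≡ ind (strictlyBetween (bot n) y z) (μ z)
      fuel z = ind-cong (strictlyBetween (bot n) y z) λ between → let z<y = rank-<-between y z between in
        mobiusF-fuel n (suc n) z (ℕP.<-≤-trans z<y (rank-≤ y)) (ℕP.<-≤-trans z<y (ℕP.m≤n⇒m≤1+n (rank-≤ y)))

  Σ-μ-equivalent : ∀ y → IsRgs 0 y → Σℤ L (λ z → ind ((z ≤ᵖ y) ∧ (y ≤ᵖ z)) (μ z)) ≡ μ y
  Σ-μ-equivalent y rgs-y = trans (Σ-cong-∈ L λ z z∈L → cong (λ b → ind b (μ z)) (equivalent⇔equal z z∈L))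
                                 (Σ-rgs-==ᵛ n 0 y rgs-y μ)
    where
      equivalent⇔equal : ∀ z → z ∈ L → ((z ≤ᵖ y) ∧ (y ≤ᵖ z)) ≡ (z ==ᵛ y)
      equivalent⇔equal z z∈L = T⇔⇒≡
        (λ z≈y → let z≤y , y≤z = T-∧⁻ {z ≤ᵖ y} z≈y in
          subst (λ w → T (z ==ᵛ w))
                (IsRgs₀-unique z y (∈rgs⇒IsRgs 0 z z∈L) rgs-y (≤ᵖ⇒⊑ z y z≤y) (≤ᵖ⇒⊑ y z y≤z))
                (≡true⇒T (==ᵛ-refl z)))
        (λ z==y → subst (λ w → T ((z ≤ᵖ w) ∧ (w ≤ᵖ z))) (==ᵛ⇒≡ z y z==y)
                        (T-∧⁺ (⊑⇒≤ᵖ z z (⊑-refl z)) (⊑⇒≤ᵖ z z (⊑-refl z))))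

  Σ-μ-below : ∀ y → IsRgs 0 y → Σℤ L (λ z → ind (z ≤ᵖ y) (μ z)) ≡ ind (y ≤ᵖ bot n) 1ℤ
  Σ-μ-below y rgs-y =
    begin
      Σℤ L (λ z → ind (z ≤ᵖ y) (μ z))
    ≡⟨ Σ-cong L (λ z → split-ind (z ≤ᵖ y) (y ≤ᵖ z) (μ z)) ⟩
      Σℤ L (λ z → ind ((z ≤ᵖ y) ∧ (y ≤ᵖ z)) (μ z) + ind (strictlyBelow z) (μ z))
    ≡⟨ Σ-+ L (λ z → ind ((z ≤ᵖ y) ∧ (y ≤ᵖ z)) (μ z)) (λ z → ind (strictlyBelow z) (μ z)) ⟩
      Σℤ L (λ z → ind ((z ≤ᵖ y) ∧ (y ≤ᵖ z)) (μ z)) + Σℤ L (λ z → ind (strictlyBelow z) (μ z))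
    ≡⟨ cong (_+ Σℤ L (λ z → ind (strictlyBelow z) (μ z))) (Σ-μ-equivalent y rgs-y) ⟩
      μ y + Σℤ L (λ z → ind (strictlyBelow z) (μ z))
    ≡⟨ bot-or-not (y ≤ᵖ bot n) refl ⟩
      ind (y ≤ᵖ bot n) 1ℤ
    ∎
    where
      open ≡-Reasoning
      strictlyBelow : Labelling n → Bool
      strictlyBelow z = (z ≤ᵖ y) ∧ not (y ≤ᵖ z)
      bot-or-not : ∀ b → (y ≤ᵖ bot n) ≡ b → μ y + Σℤ L (λ z → ind (strictlyBelow z) (μ z)) ≡ ind b 1ℤ
      bot-or-not true y≤bot = trans (cong₂ _+_ (μ-bot y y≤bot) (trans (Σ-cong L nothing-below) (Σ-zero L))) refl
        where
          nothing-below : ∀ z → ind (strictlyBelow z) (μ z) ≡ 0ℤ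
          nothing-below z with z ≤ᵖ y
          ... | false = refl
          ... | true rewrite T⇒≡true (⊑⇒≤ᵖ y z (⊑-trans {x = y} {y = bot n} {z = z}
                                                  (≤ᵖ⇒⊑ y (bot n) (≡true⇒T y≤bot)) (bot-⊑ z))) = refl
      bot-or-not false y≰bot =
        trans (cong₂ _+_ (μ-rec y y≰bot)
                         (Σ-cong L (λ z → cong (λ b → ind (b ∧ strictlyBelow z) (μ z)) (sym (bot-≤ᵖ z)))))
              (ℤP.+-inverseˡ (Σℤ L (λ z → ind (strictlyBetween (bot n) y z) (μ z))))

ΣFin : (d : ℕ) → (Fin d → ℤ) → ℤ
ΣFin zero    h = 0ℤ
ΣFin (suc d) h = h zero + ΣFin d (λ i → h (suc i))

Σ-tabulate : ∀ {A : Set} d (g : Fin d → A) (F : A → ℤ) → Σℤ (List.tabulate g) F ≡ ΣFin d (λ i → F (g i))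
Σ-tabulate zero    g F = refl
Σ-tabulate (suc d) g F = cong (λ t → F (g zero) + t) (Σ-tabulate d (λ i → g (suc i)) F)

ΣFin-cong : ∀ d {h h′ : Fin d → ℤ} → (∀ i → h i ≡ h′ i) → ΣFin d h ≡ ΣFin d h′
ΣFin-cong zero    eq = refl
ΣFin-cong (suc d) eq = cong₂ _+_ (eq zero) (ΣFin-cong d (λ i → eq (suc i)))

ΣFin-zero : ∀ d → ΣFin d (λ _ → 0ℤ) ≡ 0ℤ
ΣFin-zero zero    = refl
ΣFin-zero (suc d) = trans (ℤP.+-identityˡ _) (ΣFin-zero d)

ΣFin-const : ∀ d x → ΣFin d (λ _ → x) ≡ + d * x
ΣFin-const d x = trans (sym (Σ-tabulate d (λ i → i) (λ _ → x)))
                       (trans (Σ-const (List.allFin d) x) (cong (λ k → + k * x) (ListP.length-tabulate {n = d} (λ i → i))))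

ΣFin-+ : ∀ d h h′ → ΣFin d (λ i → h i + h′ i) ≡ ΣFin d h + ΣFin d h′
ΣFin-+ zero    h h′ = refl
ΣFin-+ (suc d) h h′ rewrite ΣFin-+ d (λ i → h (suc i)) (λ i → h′ (suc i)) =
  interchange (h zero) (h′ zero) (ΣFin d (λ i → h (suc i))) (ΣFin d (λ i → h′ (suc i)))
  where interchange : ∀ a b c d → (a + b) + (c + d) ≡ (a + c) + (b + d)
        interchange = solve-∀

ΣFin-neg : ∀ d h → ΣFin d (λ i → - h i) ≡ - ΣFin d h
ΣFin-neg zero    h = refl
ΣFin-neg (suc d) h rewrite ΣFin-neg d (λ i → h (suc i)) = sym (ℤP.neg-distrib-+ (h zero) _)

ΣFin-≟ : ∀ d (ℓ : Fin d) x → ΣFin d (λ c → ind (does (c FinP.≟ ℓ)) x) ≡ x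
ΣFin-≟ (suc d) zero    x = trans (cong (λ t → x + t) (ΣFin-zero d)) (ℤP.+-identityʳ x)
ΣFin-≟ (suc d) (suc ℓ) x = trans (ℤP.+-identityˡ _) (ΣFin-≟ d ℓ x)

functions : (d k : ℕ) → List (Vec (Fin d) k)
functions d zero    = [] ∷ []
functions d (suc k) = concatMap (λ c → map (c ∷_) (functions d k)) (List.allFin d)

Σ-functions : ∀ d k (F : Vec (Fin d) (suc k) → ℤ) →
              Σℤ (functions d (suc k)) F ≡ ΣFin d (λ c → Σℤ (functions d k) (λ f → F (c ∷ f)))
Σ-functions d k F =
  trans (Σ-concatMap (λ c → map (c ∷_) (functions d k)) (List.allFin d) F)
        (trans (Σ-tabulate d (λ i → i) (λ c → Σℤ (map (c ∷_) (functions d k)) F))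
               (ΣFin-cong d (λ c → Σ-map (c ∷_) (functions d k) F)))

-- Maps constant on the blocks of a labelling

module Respecting {B : Set} (_≟B_ : DecidableEquality B) where

  fits : Maybe B → B → Bool
  fits nothing  _ = true
  fits (just ℓ) b = does (b ≟B ℓ)

  Fits : ∀ {k} → (ℕ → Maybe B) → Vec ℕ k → Vec B k → Set
  Fits A ts v = ∀ j → T (fits (A (lookup ts j)) (lookup v j))

  respects? : ∀ {k} A (ts : Vec ℕ k) v → Dec (Fits A ts v × ts ⊑ v)
  respects? A ts v = (FinP.all? λ j → T? (fits (A (lookup ts j)) (lookup v j))) ×-dec ⊑-dec ℕP._≟_ _≟B_ ts v

  respects : ∀ {k} → (ℕ → Maybe B) → Vec ℕ k → Vec B k → Bool
  respects A ts v = isYes (respects? A ts v)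

  respects⁻ : ∀ {k} A (ts : Vec ℕ k) v → T (respects A ts v) → Fits A ts v × ts ⊑ v
  respects⁻ A ts v = toWitness {a? = respects? A ts v}

  respects⁺ : ∀ {k} A (ts : Vec ℕ k) v → Fits A ts v × ts ⊑ v → T (respects A ts v)
  respects⁺ A ts v = fromWitness {a? = respects? A ts v}

  assign : (ℕ → Maybe B) → ℕ → B → ℕ → Maybe B
  assign A t c x = if x ≡ᵇ t then just c else A x

  fits-just⁻ : ∀ {ℓ b} → T (fits (just ℓ) b) → b ≡ ℓ
  fits-just⁻ {ℓ} {b} b≡ℓ with b ≟B ℓ
  ... | yes eq = eq

  fits-just⁺ : ∀ {ℓ b} → b ≡ ℓ → T (fits (just ℓ) b)
  fits-just⁺ {ℓ} {b} b≡ℓ with b ≟B ℓ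
  ... | yes _   = tt
  ... | no  b≢ℓ = b≢ℓ b≡ℓ

  respects-∷⁻ : ∀ {k} A t c (ts : Vec ℕ k) v → Fits A (t ∷ ts) (c ∷ v) × (t ∷ ts) ⊑ (c ∷ v) →
                T (fits (A t) c) × (Fits (assign A t c) ts v × ts ⊑ v)
  respects-∷⁻ A t c ts v (fit , ts⊑v) = fit zero , fit′ , ⊑-∷⁻ ts⊑v
    where
      fit′ : Fits (assign A t c) ts v
      fit′ j with lookup ts j ≡ᵇ t in tj≡ᵇt
      ... | true  = fits-just⁺ (⊑-∷⁻ʰ ts⊑v j (≡ᵇ⇒≡ tj≡ᵇt))
      ... | false = fit (suc j)

  respects-∷⁺ : ∀ {k} A t c (ts : Vec ℕ k) v → T (fits (A t) c) × (Fits (assign A t c) ts v × ts ⊑ v) →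
                Fits A (t ∷ ts) (c ∷ v) × (t ∷ ts) ⊑ (c ∷ v)
  respects-∷⁺ A t c ts v (fit₀ , fit′ , ts⊑v) = fit , ⊑-∷⁺ same-block ts⊑v
    where
      same-block : ∀ j → lookup ts j ≡ t → lookup v j ≡ c
      same-block j refl with fit′ j
      ... | fitj rewrite ≡ᵇ-refl (lookup ts j) = fits-just⁻ fitj
      fit : Fits A (t ∷ ts) (c ∷ v)
      fit zero    = fit₀
      fit (suc j) with lookup ts j ≡ᵇ t in tj≡ᵇt | fit′ j
      ... | false | fitj = fitj
      ... | true  | fitj with refl ← ≡ᵇ⇒≡ {lookup ts j} {t} tj≡ᵇt =
        subst (λ b → T (fits (A (lookup ts j)) b)) (sym (fits-just⁻ fitj)) fit₀

  respects-∷ : ∀ {k} A t c (ts : Vec ℕ k) v → respects A (t ∷ ts) (c ∷ v) ≡ (fits (A t) c ∧ respects (assign A t c) ts v)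
  respects-∷ A t c ts v = T⇔⇒≡
    (λ r → let fit₀ , rest = respects-∷⁻ A t c ts v (respects⁻ A (t ∷ ts) (c ∷ v) r) in
           T-∧⁺ fit₀ (respects⁺ (assign A t c) ts v rest))
    (λ r → let fit₀ , rest = T-∧⁻ {fits (A t) c} r in
           respects⁺ A (t ∷ ts) (c ∷ v) (respects-∷⁺ A t c ts v (fit₀ , respects⁻ (assign A t c) ts v rest)))

  respects-[] : ∀ A → respects A [] [] ≡ true
  respects-[] A = T⇒≡true (respects⁺ A [] [] ((λ ()) , (λ ())))

  assigned : (ℕ → Maybe B) → ℕ → Bool
  assigned A x = is-just (A x)

  assigned-assign-just : ∀ A t c ℓ → A t ≡ just ℓ → ∀ x → assigned (assign A t c) x ≡ assigned A x
  assigned-assign-just A t c ℓ At≡ℓ x with x ≡ᵇ t in x≡ᵇt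
  ... | true with refl ← ≡ᵇ⇒≡ {x} {t} x≡ᵇt rewrite At≡ℓ = refl
  ... | false = refl

  assigned-assign-nothing : ∀ A t c x → assigned (assign A t c) x ≡ add (assigned A) t x
  assigned-assign-nothing A t c x with x ≡ᵇ t
  ... | true  = sym (∨-zeroʳ (assigned A x))
  ... | false = sym (∨-identityʳ (assigned A x))

open Respecting public

-- Each label not yet seen contributes a free choice among d values.
count-respecting : ∀ d k (A : ℕ → Maybe (Fin d)) (ts : Vec ℕ k) →
  Σℤ (functions d k) (λ f → ind (respects FinP._≟_ A ts f) 1ℤ) ≡ (+ d) ^ countNew (assigned FinP._≟_ A) (toList ts)
count-respecting d zero    A []       =
  trans (ℤP.+-identityʳ _) (cong (λ b → ind b 1ℤ) (respects-[] FinP._≟_ A))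
count-respecting d (suc k) A (t ∷ ts) =
  begin
    Σℤ (functions d (suc k)) (λ f → ind (respects _≟_ A (t ∷ ts) f) 1ℤ)
  ≡⟨ Σ-functions d k (λ f → ind (respects _≟_ A (t ∷ ts) f) 1ℤ) ⟩
    ΣFin d (λ c → Σℤ (functions d k) (λ f → ind (respects _≟_ A (t ∷ ts) (c ∷ f)) 1ℤ))
  ≡⟨ ΣFin-cong d (λ c → trans (Σ-cong (functions d k) (split-head c)) (Σ-ind (functions d k) (fits _≟_ (A t) c) _)) ⟩
    ΣFin d (λ c → ind (fits _≟_ (A t) c) (Σℤ (functions d k) (λ f → ind (respects _≟_ (assign _≟_ A t c) ts f) 1ℤ)))
  ≡⟨ ΣFin-cong d (λ c → cong (ind (fits _≟_ (A t) c)) (count-respecting d k (assign _≟_ A t c) ts)) ⟩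
    ΣFin d (λ c → ind (fits _≟_ (A t) c) ((+ d) ^ countNew (assigned _≟_ (assign _≟_ A t c)) (toList ts)))
  ≡⟨ by-head (A t) refl ⟩
    (+ d) ^ countNew (assigned _≟_ A) (t ∷ toList ts)
  ∎
  where
    open ≡-Reasoning
    _≟_ : DecidableEquality (Fin d)
    _≟_ = FinP._≟_
    split-head : ∀ c f → ind (respects _≟_ A (t ∷ ts) (c ∷ f)) 1ℤ
                           ≡ ind (fits _≟_ (A t) c) (ind (respects _≟_ (assign _≟_ A t c) ts f) 1ℤ)
    split-head c f = trans (cong (λ b → ind b 1ℤ) (respects-∷ _≟_ A t c ts f)) (sym (ind-ind (fits _≟_ (A t) c) _ 1ℤ))
    by-head : ∀ a → A t ≡ a →
      ΣFin d (λ c → ind (fits _≟_ (A t) c) ((+ d) ^ countNew (assigned _≟_ (assign _≟_ A t c)) (toList ts)))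
        ≡ (+ d) ^ countNew (assigned _≟_ A) (t ∷ toList ts)
    by-head (just ℓ) At≡ℓ rewrite At≡ℓ =
      trans (ΣFin-cong d (λ c → cong (λ e → ind (does (c ≟ ℓ)) ((+ d) ^ e))
                                     (countNew-cong (assigned-assign-just _≟_ A t c ℓ At≡ℓ) (toList ts))))
            (ΣFin-≟ d ℓ _)
    by-head nothing At≡nothing rewrite At≡nothing =
      trans (ΣFin-cong d (λ c → cong (λ e → (+ d) ^ e) (countNew-cong (assigned-assign-nothing _≟_ A t c) (toList ts))))
            (ΣFin-const d _)

-- Maps injective on the blocks of a labelling

bump : (ℕ → ℕ) → ℕ → ℕ → ℕ
bump s t x = if x ≡ᵇ t then suc (s x) else s x

module _ (d : ℕ) where

  open Canonical (FinP._≟_ {d}) using (elem)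

  Avoids : ∀ {k} → (ℕ → List (Fin d)) → Vec ℕ k → Vec (Fin d) k → Set
  Avoids F π f = ∀ j → T (not (elem (lookup f j) (F (lookup π j))))

  InjectiveOnBlocks : ∀ {k} → Vec ℕ k → Vec (Fin d) k → Set
  InjectiveOnBlocks π f = ∀ i j → lookup π i ≡ lookup π j → lookup f i ≡ lookup f j → i ≡ j

  separates? : ∀ {k} F (π : Vec ℕ k) f → Dec (Avoids F π f × InjectiveOnBlocks π f)
  separates? F π f =
    (FinP.all? λ j → T? (not (elem (lookup f j) (F (lookup π j))))) ×-dec
    (FinP.all? λ i → FinP.all? λ j →
       (lookup π i ℕP.≟ lookup π j) →-dec ((lookup f i FinP.≟ lookup f j) →-dec (i FinP.≟ j)))

  separates : ∀ {k} → (ℕ → List (Fin d)) → Vec ℕ k → Vec (Fin d) k → Bool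
  separates F π f = isYes (separates? F π f)

  forbid : (ℕ → List (Fin d)) → ℕ → Fin d → ℕ → List (Fin d)
  forbid F t c x = if x ≡ᵇ t then c ∷ F x else F x

  forbid-here : ∀ F t c → forbid F t c t ≡ c ∷ F t
  forbid-here F t c rewrite ≡ᵇ-refl t = refl

  separates-∷⁻ : ∀ {k} F t c (π : Vec ℕ k) f → Avoids F (t ∷ π) (c ∷ f) × InjectiveOnBlocks (t ∷ π) (c ∷ f) →
                 T (not (elem c (F t))) × (Avoids (forbid F t c) π f × InjectiveOnBlocks π f)
  separates-∷⁻ F t c π f (avoids , inj) =
    avoids zero , avoids′ , (λ i j πi≡πj fi≡fj → FinP.suc-injective (inj (suc i) (suc j) πi≡πj fi≡fj))
    where
      avoids′ : Avoids (forbid F t c) π f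
      avoids′ j with lookup π j ≡ᵇ t in πj≡ᵇt
      ... | false = avoids (suc j)
      ... | true with lookup f j FinP.≟ c
      ...   | yes fj≡c with () ← inj zero (suc j) (sym (≡ᵇ⇒≡ πj≡ᵇt)) (sym fj≡c)
      ...   | no  _    = avoids (suc j)

  separates-∷⁺ : ∀ {k} F t c (π : Vec ℕ k) f →
                 T (not (elem c (F t))) × (Avoids (forbid F t c) π f × InjectiveOnBlocks π f) →
                 Avoids F (t ∷ π) (c ∷ f) × InjectiveOnBlocks (t ∷ π) (c ∷ f)
  separates-∷⁺ F t c π f (avoids₀ , avoids′ , inj′) = avoids , inj
    where
      avoids : Avoids F (t ∷ π) (c ∷ f)
      avoids zero    = avoids₀
      avoids (suc j) with lookup π j ≡ᵇ t in πj≡ᵇt | avoids′ j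
      ... | false | avoidsj = avoidsj
      ... | true  | avoidsj = Equivalence.from T-not-≡ (∨-false⁻ʳ (Equivalence.to T-not-≡ avoidsj))
        where ∨-false⁻ʳ : ∀ {a b} → a ∨ b ≡ false → b ≡ false
              ∨-false⁻ʳ {false} eq = eq
      c-not-reused : ∀ j → t ≡ lookup π j → c ≡ lookup f j → ⊥
      c-not-reused j refl refl with avoids′ j
      ... | avoidsj rewrite forbid-here F (lookup π j) (lookup f j) with lookup f j FinP.≟ lookup f j
      ...   | yes _   = avoidsj
      ...   | no  f≢f = f≢f refl
      inj : InjectiveOnBlocks (t ∷ π) (c ∷ f)
      inj zero    zero    _     _     = refl
      inj zero    (suc j) t≡πj c≡fj = ⊥-elim (c-not-reused j t≡πj c≡fj)
      inj (suc i) zero    πi≡t fi≡c = ⊥-elim (c-not-reused i (sym πi≡t) (sym fi≡c))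
      inj (suc i) (suc j) πi≡πj fi≡fj = cong suc (inj′ i j πi≡πj fi≡fj)

  separates-∷ : ∀ {k} F t c (π : Vec ℕ k) f →
                separates F (t ∷ π) (c ∷ f) ≡ (not (elem c (F t)) ∧ separates (forbid F t c) π f)
  separates-∷ F t c π f = T⇔⇒≡
    (λ s → let avoids₀ , rest = separates-∷⁻ F t c π f (toWitness {a? = separates? F (t ∷ π) (c ∷ f)} s) in
           T-∧⁺ avoids₀ (fromWitness {a? = separates? (forbid F t c) π f} rest))
    (λ s → let avoids₀ , rest = T-∧⁻ {not (elem c (F t))} s in
           fromWitness {a? = separates? F (t ∷ π) (c ∷ f)}
             (separates-∷⁺ F t c π f (avoids₀ , toWitness {a? = separates? (forbid F t c) π f} rest)))

  separates-[] : ∀ F → separates F [] [] ≡ true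
  separates-[] F = T⇒≡true (fromWitness {a? = separates? F [] []} ((λ ()) , (λ ())))

  NoDup : List (Fin d) → Set
  NoDup []      = ⊤
  NoDup (x ∷ S) = elem x S ≡ false × NoDup S

  ind-∨ : ∀ a b x → T (not (a ∧ b)) → ind (a ∨ b) x ≡ ind a x + ind b x
  ind-∨ true  false x _ = sym (ℤP.+-identityʳ x)
  ind-∨ false b     x _ = sym (ℤP.+-identityˡ _)

  ind-not : ∀ b x → ind (not b) x ≡ x + - ind b x
  ind-not true  x = sym (ℤP.+-inverseʳ x)
  ind-not false x = sym (ℤP.+-identityʳ x)

  ΣFin-elem : ∀ S → NoDup S → ∀ x → ΣFin d (λ c → ind (elem c S) x) ≡ + length S * x
  ΣFin-elem []      _               x = trans (ΣFin-zero d) (sym (ℤP.*-zeroˡ x))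
  ΣFin-elem (s ∷ S) (s∉S , nodup) x =
    begin
      ΣFin d (λ c → ind (does (c FinP.≟ s) ∨ elem c S) x)
    ≡⟨ ΣFin-cong d (λ c → ind-∨ (does (c FinP.≟ s)) (elem c S) x (disjoint c)) ⟩
      ΣFin d (λ c → ind (does (c FinP.≟ s)) x + ind (elem c S) x)
    ≡⟨ ΣFin-+ d _ _ ⟩
      ΣFin d (λ c → ind (does (c FinP.≟ s)) x) + ΣFin d (λ c → ind (elem c S) x)
    ≡⟨ cong₂ _+_ (ΣFin-≟ d s x) (ΣFin-elem S nodup x) ⟩
      x + + length S * x
    ≡⟨ sym (ℤP.suc-* (+ length S) x) ⟩
      + length (s ∷ S) * x
    ∎
    where
      open ≡-Reasoning
      disjoint : ∀ c → T (not (does (c FinP.≟ s) ∧ elem c S))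
      disjoint c with c FinP.≟ s
      ... | no  _    = tt
      ... | yes refl = Equivalence.from T-not-≡ s∉S

  ΣFin-not-elem : ∀ S → NoDup S → ∀ x → ΣFin d (λ c → ind (not (elem c S)) x) ≡ (+ d - + length S) * x
  ΣFin-not-elem S nodup x =
    begin
      ΣFin d (λ c → ind (not (elem c S)) x)
    ≡⟨ ΣFin-cong d (λ c → ind-not (elem c S) x) ⟩
      ΣFin d (λ c → x + - ind (elem c S) x)
    ≡⟨ ΣFin-+ d (λ _ → x) (λ c → - ind (elem c S) x) ⟩
      ΣFin d (λ _ → x) + ΣFin d (λ c → - ind (elem c S) x)
    ≡⟨ cong₂ _+_ (ΣFin-const d x) (trans (ΣFin-neg d _) (cong -_ (ΣFin-elem S nodup x))) ⟩
      + d * x + - (+ length S * x)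
    ≡⟨ distrib (+ d) (+ length S) x ⟩
      (+ d - + length S) * x
    ∎
    where
      open ≡-Reasoning
      distrib : ∀ a b x → a * x + - (b * x) ≡ (a - b) * x
      distrib = solve-∀

  -- choices s π: scanning π, an entry on block t may take any of the d values
  -- except the s t values already used on that block.
  choices : (ℕ → ℕ) → List ℕ → ℤ
  choices s []      = 1ℤ
  choices s (t ∷ π) = (+ d - + s t) * choices (bump s t) π

  choices-cong : ∀ {s s′} → (∀ x → s x ≡ s′ x) → ∀ π → choices s π ≡ choices s′ π
  choices-cong s≗s′ []      = refl
  choices-cong {s} {s′} s≗s′ (t ∷ π) = cong₂ (λ a b → (+ d - + a) * b) (s≗s′ t) (choices-cong bump≗ π)
    where bump≗ : ∀ x → bump s t x ≡ bump s′ t x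
          bump≗ x with x ≡ᵇ t
          ... | true  = cong suc (s≗s′ x)
          ... | false = s≗s′ x

  count-separating : ∀ k F (π : Vec ℕ k) → (∀ x → NoDup (F x)) →
    Σℤ (functions d k) (λ f → ind (separates F π f) 1ℤ) ≡ choices (λ x → length (F x)) (toList π)
  count-separating zero    F []      _     =
    trans (ℤP.+-identityʳ _) (cong (λ b → ind b 1ℤ) (separates-[] F))
  count-separating (suc k) F (t ∷ π) nodup =
    begin
      Σℤ (functions d (suc k)) (λ f → ind (separates F (t ∷ π) f) 1ℤ)
    ≡⟨ Σ-functions d k (λ f → ind (separates F (t ∷ π) f) 1ℤ) ⟩
      ΣFin d (λ c → Σℤ (functions d k) (λ f → ind (separates F (t ∷ π) (c ∷ f)) 1ℤ))
    ≡⟨ ΣFin-cong d (λ c → trans (Σ-cong (functions d k) (split-head c)) (Σ-ind (functions d k) (not (elem c (F t))) _)) ⟩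
      ΣFin d (λ c → ind (not (elem c (F t))) (Σℤ (functions d k) (λ f → ind (separates (forbid F t c) π f) 1ℤ)))
    ≡⟨ ΣFin-cong d (λ c → ind-cong (not (elem c (F t))) (λ c∉ → count-tail c c∉)) ⟩
      ΣFin d (λ c → ind (not (elem c (F t))) (choices (bump (λ x → length (F x)) t) (toList π)))
    ≡⟨ ΣFin-not-elem (F t) (nodup t) _ ⟩
      choices (λ x → length (F x)) (t ∷ toList π)
    ∎
    where
      open ≡-Reasoning
      split-head : ∀ c f → ind (separates F (t ∷ π) (c ∷ f)) 1ℤ
                             ≡ ind (not (elem c (F t))) (ind (separates (forbid F t c) π f) 1ℤ)
      split-head c f = trans (cong (λ b → ind b 1ℤ) (separates-∷ F t c π f)) (sym (ind-ind (not (elem c (F t))) _ 1ℤ))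
      nodup′ : ∀ c → T (not (elem c (F t))) → ∀ x → NoDup (forbid F t c x)
      nodup′ c c∉ x with x ≡ᵇ t in x≡ᵇt
      ... | false = nodup x
      ... | true with refl ← ≡ᵇ⇒≡ {x} {t} x≡ᵇt = Equivalence.to T-not-≡ c∉ , nodup x
      length-forbid : ∀ c x → length (forbid F t c x) ≡ bump (λ y → length (F y)) t x
      length-forbid c x with x ≡ᵇ t
      ... | true  = refl
      ... | false = refl
      count-tail : ∀ c → T (not (elem c (F t))) →
                   Σℤ (functions d k) (λ f → ind (separates (forbid F t c) π f) 1ℤ)
                     ≡ choices (bump (λ x → length (F x)) t) (toList π)
      count-tail c c∉ = trans (count-separating k (forbid F t c) π (nodup′ c c∉)) (choices-cong (length-forbid c) (toList π))

Πℤ : List ℕ → (ℕ → ℤ) → ℤ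
Πℤ xs h = foldr (λ ℓ acc → h ℓ * acc) 1ℤ xs

Π-cong : ∀ xs {h h′ : ℕ → ℤ} → (∀ x → h x ≡ h′ x) → Πℤ xs h ≡ Πℤ xs h′
Π-cong []       eq = refl
Π-cong (x ∷ xs) eq = cong₂ _*_ (eq x) (Π-cong xs eq)

Π-filter : ∀ {P : ℕ → Set} (P? : ∀ y → Dec (P y)) xs h →
           Πℤ (filter P? xs) h ≡ Πℤ xs (λ y → if does (P? y) then h y else 1ℤ)
Π-filter P? []       h = refl
Π-filter P? (x ∷ xs) h with does (P? x)
... | true  = cong (h x *_) (Π-filter P? xs h)
... | false = trans (Π-filter P? xs h) (sym (ℤP.*-identityˡ _))

+-foldr-* : ∀ (h : ℕ → ℕ) xs → + foldr (λ ℓ acc → h ℓ ℕ.* acc) 1 xs ≡ Πℤ xs (λ ℓ → + h ℓ)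
+-foldr-* h []       = refl
+-foldr-* h (x ∷ xs) = trans (ℤP.pos-* (h x) _) (cong (+ h x *_) (+-foldr-* h xs))

occurrences : ℕ → List ℕ → ℕ
occurrences ℓ xs = length (filter (λ x → x ℕP.≟ ℓ) xs)

NoDupℕ : List ℕ → Set
NoDupℕ []      = ⊤
NoDupℕ (x ∷ U) = elemᵇ x U ≡ false × NoDupℕ U

elemᵇ-filter⁻ : ∀ {P : ℕ → Set} (P? : ∀ y → Dec (P y)) a U → elemᵇ a (filter P? U) ≡ true → elemᵇ a U ≡ true
elemᵇ-filter⁻ P? a (u ∷ U) a∈ with does (P? u)
elemᵇ-filter⁻ P? a (u ∷ U) a∈ | true with u ≡ᵇ a
... | true  = refl
... | false = elemᵇ-filter⁻ P? a U a∈
elemᵇ-filter⁻ P? a (u ∷ U) a∈ | false with u ≡ᵇ a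
... | true  = refl
... | false = elemᵇ-filter⁻ P? a U a∈

elemᵇ-filter⁺ : ∀ {P : ℕ → Set} (P? : ∀ y → Dec (P y)) a U → elemᵇ a U ≡ true → T (does (P? a)) →
                elemᵇ a (filter P? U) ≡ true
elemᵇ-filter⁺ P? a (u ∷ U) a∈ Pa with u ≡ᵇ a in u≡ᵇa
... | true with refl ← ≡ᵇ⇒≡ {u} {a} u≡ᵇa with does (P? u)
...   | true rewrite ≡ᵇ-refl u = refl
elemᵇ-filter⁺ P? a (u ∷ U) a∈ Pa | false with does (P? u)
... | true rewrite u≡ᵇa = elemᵇ-filter⁺ P? a U a∈ Pa
... | false = elemᵇ-filter⁺ P? a U a∈ Pa

NoDupℕ-filter : ∀ {P : ℕ → Set} (P? : ∀ y → Dec (P y)) U → NoDupℕ U → NoDupℕ (filter P? U)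
NoDupℕ-filter P? []      _              = tt
NoDupℕ-filter P? (u ∷ U) (u∉U , nodup) with does (P? u)
... | true  = ¬T⇒≡false (λ u∈ → subst T u∉U (≡true⇒T (elemᵇ-filter⁻ P? u U (T⇒≡true u∈))))
            , NoDupℕ-filter P? U nodup
... | false = NoDupℕ-filter P? U nodup

elemᵇ-filter-≢ : ∀ x U → elemᵇ x (filter (λ y → ¬? (T? (x ≡ᵇ y))) U) ≡ false
elemᵇ-filter-≢ x []      = refl
elemᵇ-filter-≢ x (u ∷ U) with x ≡ᵇ u in x≡ᵇu
... | true  = elemᵇ-filter-≢ x U
... | false rewrite ≡ᵇ-sym u x | x≡ᵇu = elemᵇ-filter-≢ x U

dedup-NoDupℕ : ∀ xs → NoDupℕ (dedup xs)
dedup-NoDupℕ []       = tt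
dedup-NoDupℕ (x ∷ xs) = elemᵇ-filter-≢ x (dedup xs) , NoDupℕ-filter _ (dedup xs) (dedup-NoDupℕ xs)

elemᵇ-dedup : ∀ x xs → elemᵇ x xs ≡ true → elemᵇ x (dedup xs) ≡ true
elemᵇ-dedup x (y ∷ ys) x∈ with y ≡ᵇ x in y≡ᵇx
... | true  = refl
... | false = elemᵇ-filter⁺ (λ z → ¬? (T? (y ≡ᵇ z))) x (dedup ys) (elemᵇ-dedup x ys x∈)
                            (subst (λ b → T (not b)) (sym y≡ᵇx) tt)

occurrences-absent : ∀ x xs → elemᵇ x xs ≡ false → occurrences x xs ≡ 0
occurrences-absent x []       _  = refl
occurrences-absent x (y ∷ ys) x∉ with y ≡ᵇ x
... | false = occurrences-absent x ys x∉

Π-extract : ∀ x U → NoDupℕ U → ∀ h →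
            Πℤ U h ≡ (if elemᵇ x U then h x else 1ℤ) * Πℤ U (λ ℓ → if x ≡ᵇ ℓ then 1ℤ else h ℓ)
Π-extract x []      _              h = refl
Π-extract x (u ∷ U) (u∉U , nodup) h with u ≡ᵇ x in u≡ᵇx
... | true with refl ← ≡ᵇ⇒≡ {u} {x} u≡ᵇx rewrite ≡ᵇ-refl u =
  cong (h u *_) (trans (Π-extract u U nodup h)
                       (cong (λ b → (if b then h u else 1ℤ) * Πℤ U (λ ℓ → if u ≡ᵇ ℓ then 1ℤ else h ℓ)) u∉U))
... | false rewrite ≡ᵇ-sym x u | u≡ᵇx =
  trans (cong (h u *_) (Π-extract x U nodup h))
        (swap (h u) (if elemᵇ x U then h x else 1ℤ) (Πℤ U (λ ℓ → if x ≡ᵇ ℓ then 1ℤ else h ℓ)))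
  where swap : ∀ a b c → a * (b * c) ≡ b * (a * c)
        swap = solve-∀

module _ (d : ℕ) where

  fallFrom : ℕ → ℕ → ℤ
  fallFrom s zero    = 1ℤ
  fallFrom s (suc c) = (+ d - + s) * fallFrom (suc s) c

  fallFrom-suc : ∀ s c → fallFrom s (suc c) ≡ fallFrom s c * (+ d - + (s ℕ.+ c))
  fallFrom-suc s zero    = trans (ℤP.*-identityʳ _)
                                 (trans (cong (λ q → + d - + q) (sym (ℕP.+-identityʳ s))) (sym (ℤP.*-identityˡ _)))
  fallFrom-suc s (suc c) =
    trans (cong ((+ d - + s) *_) (fallFrom-suc (suc s) c))
          (trans (sym (ℤP.*-assoc (+ d - + s) (fallFrom (suc s) c) _))
                 (cong (λ q → fallFrom s (suc c) * (+ d - + q)) (sym (ℕP.+-suc s c))))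

  fall-vanishes : ∀ c → d < c → fall d c ≡ 0
  fall-vanishes (suc c) d<1+c = trans (cong (fall d c ℕ.*_) (ℕP.m≤n⇒m∸n≡0 (ℕP.≤-pred d<1+c))) (ℕP.*-zeroʳ (fall d c))

  -- fall uses truncated subtraction; it only matters once a factor d ∸ d = 0 has appeared.
  fall≡fallFrom : ∀ c → + fall d c ≡ fallFrom 0 c
  fall≡fallFrom zero    = refl
  fall≡fallFrom (suc c) =
    trans (ℤP.pos-* (fall d c) (d ∸ c))
          (trans (cong (_* + (d ∸ c)) (fall≡fallFrom c))
                 (trans (last-factor (ℕP.≤-<-connex c d)) (sym (fallFrom-suc 0 c))))
    where
      last-factor : c ≤ d ⊎ d < c → fallFrom 0 c * + (d ∸ c) ≡ fallFrom 0 c * (+ d - + c)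
      last-factor (inj₁ c≤d) = cong (fallFrom 0 c *_) (sym (trans (ℤP.[+m]-[+n]≡m⊖n d c) (ℤP.⊖-≥ c≤d)))
      last-factor (inj₂ d<c) rewrite sym (fall≡fallFrom c) | fall-vanishes c d<c =
        trans (ℤP.*-zeroˡ (+ (d ∸ c))) (sym (ℤP.*-zeroˡ (+ d - + c)))

  choices≡Π-fallFrom : ∀ s xs → choices d s xs ≡ Πℤ (dedup xs) (λ ℓ → fallFrom (s ℓ) (occurrences ℓ xs))
  choices≡Π-fallFrom s []       = refl
  choices≡Π-fallFrom s (x ∷ xs) =
    begin
      (+ d - + s x) * choices d (bump s x) xs
    ≡⟨ cong ((+ d - + s x) *_) (trans (choices≡Π-fallFrom (bump s x) xs)
                                      (Π-extract x (dedup xs) (dedup-NoDupℕ xs) tailFactor)) ⟩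
      (+ d - + s x) * ((if elemᵇ x (dedup xs) then tailFactor x else 1ℤ) * others)
    ≡⟨ cong (λ q → (+ d - + s x) * (q * others)) x-factor ⟩
      (+ d - + s x) * (tailFactor x * others)
    ≡⟨ sym (ℤP.*-assoc (+ d - + s x) (tailFactor x) others) ⟩
      ((+ d - + s x) * tailFactor x) * others
    ≡⟨ cong (_* others) x-first ⟩
      factor x * others
    ≡⟨ cong (factor x *_) (sym (trans (Π-filter (λ y → ¬? (T? (x ≡ᵇ y))) (dedup xs) factor)
                                      (Π-cong (dedup xs) others≗))) ⟩
      Πℤ (dedup (x ∷ xs)) factor
    ∎
    where
      open ≡-Reasoning
      factor : ℕ → ℤ
      factor ℓ = fallFrom (s ℓ) (occurrences ℓ (x ∷ xs))
      tailFactor : ℕ → ℤ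
      tailFactor ℓ = fallFrom (bump s x ℓ) (occurrences ℓ xs)
      others : ℤ
      others = Πℤ (dedup xs) (λ ℓ → if x ≡ᵇ ℓ then 1ℤ else tailFactor ℓ)
      x-first : (+ d - + s x) * tailFactor x ≡ factor x
      x-first rewrite ≡ᵇ-refl x = refl
      x-factor : (if elemᵇ x (dedup xs) then tailFactor x else 1ℤ) ≡ tailFactor x
      x-factor with elemᵇ x (dedup xs) in x∈
      ... | true  = refl
      ... | false rewrite occurrences-absent x xs
                            (¬T⇒≡false (λ t → subst T x∈ (≡true⇒T (elemᵇ-dedup x xs (T⇒≡true t))))) = refl
      others≗ : ∀ ℓ → (if not (x ≡ᵇ ℓ) then factor ℓ else 1ℤ) ≡ (if x ≡ᵇ ℓ then 1ℤ else tailFactor ℓ)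
      others≗ ℓ with x ≡ᵇ ℓ in x≡ᵇℓ
      ... | true  = refl
      ... | false rewrite ≡ᵇ-sym ℓ x | x≡ᵇℓ = refl

  fallP≡choices : ∀ {n} (π : Labelling n) → + fallP d π ≡ choices d (λ _ → 0) (toList π)
  fallP≡choices π =
    trans (+-foldr-* (λ ℓ → fall d (blockSize π ℓ)) (labels π))
          (trans (Π-cong (labels π) (λ ℓ → fall≡fallFrom (occurrences ℓ (toList π))))
                 (sym (choices≡Π-fallFrom (λ _ → 0) (toList π))))

-- Sums over the partitions above a given one

freshLabels : ∀ {k} → ℕ → Vec ℕ k → ℕ
freshLabels m []      = 0
freshLabels m (ℓ ∷ v) = if ℓ ≡ᵇ m then suc (freshLabels (suc m) v) else freshLabels m v

freshLabels-< : ∀ {k} {m ℓ} (v : Vec ℕ k) → ℓ < m → freshLabels m (ℓ ∷ v) ≡ freshLabels m v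
freshLabels-< {m = m} {ℓ} v ℓ<m =
  cong (λ b → if b then suc (freshLabels (suc m) v) else freshLabels m v) (≡ᵇ-false (ℕP.<⇒≢ ℓ<m))

<ᵇ-suc : ∀ x m → (x <ᵇ suc m) ≡ ((x <ᵇ m) ∨ (x ≡ᵇ m))
<ᵇ-suc x m = T⇔⇒≡ to from
  where
    to : T (x <ᵇ suc m) → T ((x <ᵇ m) ∨ (x ≡ᵇ m))
    to x<1+m with ℕP.m≤n⇒m<n∨m≡n (ℕP.≤-pred (ℕP.<ᵇ⇒< x (suc m) x<1+m))
    ... | inj₁ x<m  rewrite T⇒≡true (ℕP.<⇒<ᵇ x<m) = tt
    ... | inj₂ refl rewrite ≡ᵇ-refl x | ∨-zeroʳ (x <ᵇ x) = tt
    from : T ((x <ᵇ m) ∨ (x ≡ᵇ m)) → T (x <ᵇ suc m)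
    from h with x <ᵇ m in x<ᵇm
    ... | true  = ℕP.<⇒<ᵇ (ℕP.m≤n⇒m≤1+n (ℕP.<ᵇ⇒< x m (≡true⇒T x<ᵇm)))
    ... | false rewrite ℕP.≡ᵇ⇒≡ x m h = ℕP.<⇒<ᵇ (ℕP.≤-refl {suc m})

countNew-IsRgs : ∀ {k} m (v : Vec ℕ k) D → IsRgs m v → (∀ x → D x ≡ (x <ᵇ m)) → countNew D (toList v) ≡ freshLabels m v
countNew-IsRgs m []      D _ _ = refl
countNew-IsRgs m (ℓ ∷ v) D (ℓ≤m , rgs-v) D≗<m with ℕP.m≤n⇒m<n∨m≡n ℓ≤m
... | inj₁ ℓ<m rewrite D≗<m ℓ | T⇒≡true (ℕP.<⇒<ᵇ ℓ<m) | ≡ᵇ-false (ℕP.<⇒≢ ℓ<m) = countNew-IsRgs m v D rgs-v D≗<m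
... | inj₂ refl rewrite D≗<m ℓ | ¬T⇒≡false (λ ℓ<ℓ → ℕP.<-irrefl refl (ℕP.<ᵇ⇒< ℓ ℓ ℓ<ℓ)) | ≡ᵇ-refl ℓ =
  cong suc (countNew-IsRgs (suc ℓ) v (add D ℓ) rgs-v (λ x → trans (cong (_∨ (x ≡ᵇ ℓ)) (D≗<m x)) (sym (<ᵇ-suc x ℓ))))

nBlocks-IsRgs : ∀ {k} (π : Vec ℕ k) → IsRgs 0 π → nBlocks π ≡ freshLabels 0 π
nBlocks-IsRgs π rgs-π = trans (nBlocks≡blockCount π) (countNew-IsRgs 0 π none rgs-π (λ _ → refl))

≤ᵖ≡respects : ∀ {k} (τ π : Vec ℕ k) → (τ ≤ᵖ π) ≡ respects ℕP._≟_ (λ _ → nothing) τ π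
≤ᵖ≡respects τ π = T⇔⇒≡ (λ τ≤π → respects⁺ ℕP._≟_ (λ _ → nothing) τ π ((λ _ → tt) , ≤ᵖ⇒⊑ τ π τ≤π))
                        (λ r → ⊑⇒≤ᵖ τ π (proj₂ (respects⁻ ℕP._≟_ (λ _ → nothing) τ π r)))

module Above (w : ℕ → ℤ) where

  -- upperSum m j sums w(m + #new blocks) over the ways of sending j further
  -- blocks either into one of m existing blocks or into a new one.
  upperSum : ℕ → ℕ → ℤ
  upperSum m zero    = w m
  upperSum m (suc j) = + m * upperSum m j + upperSum (suc m) j

  AssignedBelow : (ℕ → Maybe ℕ) → ℕ → Set
  AssignedBelow A m = ∀ x ℓ → A x ≡ just ℓ → ℓ < m

  assign-below : ∀ A m t ℓ → AssignedBelow A m → ℓ < m → AssignedBelow (assign ℕP._≟_ A t ℓ) m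
  assign-below A m t ℓ below ℓ<m x ℓ′ eq with x ≡ᵇ t
  ... | true with refl ← eq = ℓ<m
  ... | false = below x ℓ′ eq

  below-suc : ∀ A m → AssignedBelow A m → AssignedBelow A (suc m)
  below-suc A m below x ℓ eq = ℕP.m≤n⇒m≤1+n (below x ℓ eq)

  Σ-rgs-respecting : ∀ k m (A : ℕ → Maybe ℕ) (ts : Vec ℕ k) → AssignedBelow A m →
    Σℤ (rgs k m) (λ v → ind (respects ℕP._≟_ A ts v) (w (m ℕ.+ freshLabels m v)))
      ≡ upperSum m (countNew (assigned ℕP._≟_ A) (toList ts))
  Σ-rgs-respecting zero    m A []       _ =
    trans (ℤP.+-identityʳ _) (trans (cong (λ b → ind b (w (m ℕ.+ 0))) (respects-[] ℕP._≟_ A)) (cong w (ℕP.+-identityʳ m)))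
  Σ-rgs-respecting (suc k) m A (t ∷ ts) below =
    begin
      Σℤ (rgs (suc k) m) summand
    ≡⟨ Σ-rgs-∷ k m summand ⟩
      Σℤ (upTo (suc m)) (λ ℓ → Σℤ (rgs k (grow m ℓ)) (λ v → summand (ℓ ∷ v)))
    ≡⟨ Σ-cong (upTo (suc m)) split-head ⟩
      Σℤ (upTo (suc m)) (λ ℓ → ind (fits _≟_ (A t) ℓ) (tailSum ℓ))
    ≡⟨ by-head (A t) refl ⟩
      upperSum m (countNew (assigned _≟_ A) (t ∷ toList ts))
    ∎
    where
      open ≡-Reasoning
      _≟_ : DecidableEquality ℕ
      _≟_ = ℕP._≟_
      summand : Vec ℕ (suc k) → ℤ
      summand v = ind (respects _≟_ A (t ∷ ts) v) (w (m ℕ.+ freshLabels m v))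
      tailSum : ℕ → ℤ
      tailSum ℓ = Σℤ (rgs k (grow m ℓ)) λ v →
                    ind (respects _≟_ (assign _≟_ A t ℓ) ts v) (w (m ℕ.+ freshLabels m (ℓ ∷ v)))
      split-head : ∀ ℓ → Σℤ (rgs k (grow m ℓ)) (λ v → summand (ℓ ∷ v)) ≡ ind (fits _≟_ (A t) ℓ) (tailSum ℓ)
      split-head ℓ =
        trans (Σ-cong (rgs k (grow m ℓ)) λ v →
                 trans (cong (λ b → ind b (w (m ℕ.+ freshLabels m (ℓ ∷ v)))) (respects-∷ _≟_ A t ℓ ts v))
                       (sym (ind-ind (fits _≟_ (A t) ℓ) _ _)))
              (Σ-ind (rgs k (grow m ℓ)) (fits _≟_ (A t) ℓ) _)
      rest : ℕ → ℕ
      rest ℓ = countNew (assigned _≟_ (assign _≟_ A t ℓ)) (toList ts)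
      tailSum-old : ∀ ℓ → ℓ < m → tailSum ℓ ≡ upperSum m (rest ℓ)
      tailSum-old ℓ ℓ<m rewrite grow-< ℓ<m =
        trans (Σ-cong (rgs k m) λ v →
                 cong (λ q → ind (respects _≟_ (assign _≟_ A t ℓ) ts v) (w (m ℕ.+ q))) (freshLabels-< v ℓ<m))
              (Σ-rgs-respecting k m (assign _≟_ A t ℓ) ts (assign-below A m t ℓ below ℓ<m))
      tailSum-new : tailSum m ≡ upperSum (suc m) (rest m)
      tailSum-new rewrite grow-≡ m =
        trans (Σ-cong (rgs k (suc m)) (λ v → cong (λ q → ind (respects _≟_ (assign _≟_ A t m) ts v) (w q)) (fresh v)))
              (Σ-rgs-respecting k (suc m) (assign _≟_ A t m) ts (assign-below A (suc m) t m (below-suc A m below) ℕP.≤-refl))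
        where fresh : ∀ v → m ℕ.+ freshLabels m (m ∷ v) ≡ suc m ℕ.+ freshLabels (suc m) v
              fresh v rewrite ≡ᵇ-refl m = ℕP.+-suc m _
      by-head : ∀ a → A t ≡ a → Σℤ (upTo (suc m)) (λ ℓ → ind (fits _≟_ (A t) ℓ) (tailSum ℓ))
                                  ≡ upperSum m (countNew (assigned _≟_ A) (t ∷ toList ts))
      by-head (just ℓ₀) At≡ℓ₀ rewrite At≡ℓ₀ =
        trans (Σ-upTo-≡ᵇ (suc m) ℓ₀ (ℕP.m≤n⇒m≤1+n ℓ₀<m) tailSum)
              (trans (tailSum-old ℓ₀ ℓ₀<m)
                     (cong (upperSum m) (countNew-cong (assigned-assign-just _≟_ A t ℓ₀ ℓ₀ At≡ℓ₀) (toList ts))))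
        where ℓ₀<m : ℓ₀ < m
              ℓ₀<m = below t ℓ₀ At≡ℓ₀
      by-head nothing At≡nothing rewrite At≡nothing =
        Σ-upTo-split m tailSum (λ ℓ ℓ<m → trans (tailSum-old ℓ ℓ<m) (cong (upperSum m) (unassigned ℓ)))
                               (trans tailSum-new (cong (upperSum (suc m)) (unassigned m)))
        where unassigned : ∀ ℓ → rest ℓ ≡ countNew (add (assigned _≟_ A) t) (toList ts)
              unassigned ℓ = countNew-cong (assigned-assign-nothing _≟_ A t ℓ) (toList ts)

  -- Identifying each π ≥ τ with the restricted growth string of π and
  -- reading it through the blocks of τ.
  Σ-above : ∀ n (τ : Labelling n) → Σℤ (Partitions n) (λ π → ind (τ ≤ᵖ π) (w (nBlocks π))) ≡ upperSum 0 (nBlocks τ)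
  Σ-above n τ =
    trans (Σ-cong-∈ (Partitions n) λ π π∈ →
             cong₂ ind (≤ᵖ≡respects τ π) (cong w (nBlocks-IsRgs π (∈rgs⇒IsRgs 0 π π∈))))
          (trans (Σ-rgs-respecting n 0 (λ _ → nothing) τ (λ _ _ ()))
                 (cong (upperSum 0) (sym (nBlocks≡blockCount τ))))

signedFactorial : ℕ → ℤ
signedFactorial k = ((- + 1) ^ k) * + ((k ∸ 1) !)

open Above signedFactorial using () renaming (upperSum to signedUpperSum)

-- m·(-1)^m (m-1)! + (-1)^(m+1) m! = 0 for m ≥ 1.
signedUpperSum-vanishes : ∀ m j → signedUpperSum (suc m) (suc j) ≡ 0ℤ
signedUpperSum-vanishes m zero = cancel (+ suc m) ((- + 1) ^ suc m) (+ (m !)) (ℤP.pos-* (suc m) (m !))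
  where
    cancel : ∀ c a b → + (suc m ℕ.* m !) ≡ c * b → c * (a * b) + ((- + 1) * a) * + (suc m !) ≡ 0ℤ
    cancel c a b eq = trans (cong (λ q → c * (a * b) + ((- + 1) * a) * q) eq) (ring c a b)
      where ring : ∀ c a b → c * (a * b) + ((- + 1) * a) * (c * b) ≡ 0ℤ
            ring = solve-∀
signedUpperSum-vanishes m (suc j) =
  trans (cong₂ (λ a b → + suc m * a + b) (signedUpperSum-vanishes m j) (signedUpperSum-vanishes (suc m) j))
        (trans (ℤP.+-identityʳ _) (ℤP.*-zeroʳ (+ suc m)))

signedUpperSum-from-zero : ∀ c → signedUpperSum 0 (suc c) ≡ ind (c ≡ᵇ 0) (- 1ℤ)
signedUpperSum-from-zero zero    = refl
signedUpperSum-from-zero (suc c) = trans (ℤP.+-identityˡ _) (signedUpperSum-vanishes 0 c)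

-- (d)_π = Σ_{ρ ≤ π} d^|ρ| μ(0_n, ρ)

⊑-zip⁻ : ∀ {A B C : Set} {k} (x : Vec A k) (y : Vec B k) (z : Vec C k) → x ⊑ Vec.zip y z → x ⊑ y × x ⊑ z
⊑-zip⁻ x y z x⊑yz = (λ i j eq → cong proj₁ (same i j eq)) , (λ i j eq → cong proj₂ (same i j eq))
  where same : ∀ i j → lookup x i ≡ lookup x j → (lookup y i , lookup z i) ≡ (lookup y j , lookup z j)
        same i j eq = trans (sym (VecP.lookup-zip i y z)) (trans (x⊑yz i j eq) (VecP.lookup-zip j y z))

⊑-zip⁺ : ∀ {A B C : Set} {k} (x : Vec A k) (y : Vec B k) (z : Vec C k) → x ⊑ y → x ⊑ z → x ⊑ Vec.zip y z
⊑-zip⁺ x y z x⊑y x⊑z i j eq =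
  trans (VecP.lookup-zip i y z) (trans (cong₂ _,_ (x⊑y i j eq) (x⊑z i j eq)) (sym (VecP.lookup-zip j y z)))

module Expansion (n d : ℕ) where

  open Möbius n
  open Canonical (×P.≡-dec ℕP._≟_ (FinP._≟_ {d})) using ()
    renaming (canon to canonPair; ⊑-canon to ⊑-canonPair; canon-⊑ to canonPair-⊑; canon-IsRgs to canonPair-IsRgs)

  -- The meet of π with the kernel of f.
  meet : Labelling n → Vec (Fin d) n → Labelling n
  meet π f = canonPair (Vec.zip π f)

  ≤-meet : ∀ π f ρ → ((ρ ≤ᵖ π) ∧ respects FinP._≟_ (λ _ → nothing) ρ f) ≡ (ρ ≤ᵖ meet π f)
  ≤-meet π f ρ = T⇔⇒≡
    (λ below → let ρ≤π , r = T-∧⁻ {ρ ≤ᵖ π} below in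
      ⊑⇒≤ᵖ ρ (meet π f) (⊑-trans {x = ρ} {y = Vec.zip π f} {z = meet π f}
        (⊑-zip⁺ ρ π f (≤ᵖ⇒⊑ ρ π ρ≤π) (proj₂ (respects⁻ FinP._≟_ (λ _ → nothing) ρ f r)))
        (⊑-canonPair (Vec.zip π f))))
    (λ ρ≤meet → let ρ⊑π , ρ⊑f = ⊑-zip⁻ ρ π f (⊑-trans {x = ρ} {y = meet π f} {z = Vec.zip π f}
                                                        (≤ᵖ⇒⊑ ρ (meet π f) ρ≤meet) (canonPair-⊑ (Vec.zip π f))) in
      T-∧⁺ (⊑⇒≤ᵖ ρ π ρ⊑π) (respects⁺ FinP._≟_ (λ _ → nothing) ρ f ((λ _ → tt) , ρ⊑f)))

  meet-≤-bot : ∀ π f → (meet π f ≤ᵖ bot n) ≡ separates d (λ _ → []) π f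
  meet-≤-bot π f = T⇔⇒≡
    (λ meet≤bot → fromWitness {a? = separates? d (λ _ → []) π f} ((λ _ → tt) , λ i j πi≡πj fi≡fj →
       let same = trans (VecP.lookup-zip i π f) (trans (cong₂ _,_ πi≡πj fi≡fj) (sym (VecP.lookup-zip j π f)))
           eq = ≤ᵖ⇒⊑ (meet π f) (bot n) meet≤bot i j (⊑-canonPair (Vec.zip π f) i j same) in
       FinP.toℕ-injective (trans (sym (lookup-bot i)) (trans eq (lookup-bot j)))))
    (λ sep → ⊑⇒≤ᵖ (meet π f) (bot n) λ i j eq →
       let πi≡πj , fi≡fj = ⊑-zip⁻ (meet π f) π f (canonPair-⊑ (Vec.zip π f)) in
       cong (lookup (bot n)) (proj₂ (toWitness {a? = separates? d (λ _ → []) π f} sep) i j (πi≡πj i j eq) (fi≡fj i j eq)))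

  pow-nBlocks : ∀ ρ → (+ d) ^ nBlocks ρ ≡ Σℤ (functions d n) (λ f → ind (respects FinP._≟_ (λ _ → nothing) ρ f) 1ℤ)
  pow-nBlocks ρ = trans (cong ((+ d) ^_) (nBlocks≡blockCount ρ)) (sym (count-respecting d n (λ _ → nothing) ρ))

  -- Count the maps f : [n] → [d] by the meet of π with their kernel.
  fallP≡Σ-below : ∀ π → + fallP d π ≡ Σℤ L (λ ρ → ind (ρ ≤ᵖ π) ((+ d) ^ nBlocks ρ * μ ρ))
  fallP≡Σ-below π =
    begin
      + fallP d π
    ≡⟨ fallP≡choices d π ⟩
      choices d (λ _ → 0) (toList π)
    ≡⟨ sym (count-separating d n (λ _ → []) π (λ _ → tt)) ⟩
      Σℤ F (λ f → ind (separates d (λ _ → []) π f) 1ℤ)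
    ≡⟨ Σ-cong F (λ f → sym (trans (Σ-μ-below (meet π f) (canonPair-IsRgs (Vec.zip π f)))
                                  (cong (λ b → ind b 1ℤ) (meet-≤-bot π f)))) ⟩
      Σℤ F (λ f → Σℤ L (λ ρ → ind (ρ ≤ᵖ meet π f) (μ ρ)))
    ≡⟨ sym (Σ-swap L F (λ ρ f → ind (ρ ≤ᵖ meet π f) (μ ρ))) ⟩
      Σℤ L (λ ρ → Σℤ F (λ f → ind (ρ ≤ᵖ meet π f) (μ ρ)))
    ≡⟨ Σ-cong L (λ ρ → sym (term ρ)) ⟩
      Σℤ L (λ ρ → ind (ρ ≤ᵖ π) ((+ d) ^ nBlocks ρ * μ ρ))
    ∎
    where
      open ≡-Reasoning
      F : List (Vec (Fin d) n)
      F = functions d n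
      constOn : Labelling n → Vec (Fin d) n → Bool
      constOn = respects FinP._≟_ (λ _ → nothing)
      term : ∀ ρ → ind (ρ ≤ᵖ π) ((+ d) ^ nBlocks ρ * μ ρ) ≡ Σℤ F (λ f → ind (ρ ≤ᵖ meet π f) (μ ρ))
      term ρ =
        begin
          ind (ρ ≤ᵖ π) ((+ d) ^ nBlocks ρ * μ ρ)
        ≡⟨ cong (λ x → ind (ρ ≤ᵖ π) (x * μ ρ)) (pow-nBlocks ρ) ⟩
          ind (ρ ≤ᵖ π) (Σℤ F (λ f → ind (constOn ρ f) 1ℤ) * μ ρ)
        ≡⟨ cong (ind (ρ ≤ᵖ π)) (sym (Σ-*ʳ F (μ ρ) (λ f → ind (constOn ρ f) 1ℤ))) ⟩
          ind (ρ ≤ᵖ π) (Σℤ F (λ f → ind (constOn ρ f) 1ℤ * μ ρ))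
        ≡⟨ sym (Σ-ind F (ρ ≤ᵖ π) (λ f → ind (constOn ρ f) 1ℤ * μ ρ)) ⟩
          Σℤ F (λ f → ind (ρ ≤ᵖ π) (ind (constOn ρ f) 1ℤ * μ ρ))
        ≡⟨ Σ-cong F (λ f → cong (ind (ρ ≤ᵖ π)) (trans (ind-* (constOn ρ f) 1ℤ (μ ρ))
                                                      (cong (ind (constOn ρ f)) (ℤP.*-identityˡ (μ ρ))))) ⟩
          Σℤ F (λ f → ind (ρ ≤ᵖ π) (ind (constOn ρ f) (μ ρ)))
        ≡⟨ Σ-cong F (λ f → trans (ind-ind (ρ ≤ᵖ π) (constOn ρ f) (μ ρ)) (cong (λ b → ind b (μ ρ)) (≤-meet π f ρ))) ⟩
          Σℤ F (λ f → ind (ρ ≤ᵖ meet π f) (μ ρ))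
        ∎

-- Joins in 𝒫(n)

map-≡⇒≡ : ∀ {A B : Set} (f g : A → B) xs → map f xs ≡ map g xs → ∀ {x} → x ∈ xs → f x ≡ g x
map-≡⇒≡ f g (y ∷ ys) eq (here refl) = proj₁ (ListP.∷-injective eq)
map-≡⇒≡ f g (y ∷ ys) eq (there x∈)  = map-≡⇒≡ f g ys (proj₂ (ListP.∷-injective eq)) x∈

⊑-top : ∀ {k} (v : Vec ℕ k) → v ⊑ top k
⊑-top v i j _ = trans (VecP.lookup-replicate i 0) (sym (VecP.lookup-replicate j 0))

blockCount-top : ∀ k → blockCount (top (suc k)) ≡ 1
blockCount-top zero    = refl
blockCount-top (suc k) = trans (blockCount-∷ 0 (top (suc k))) (blockCount-top k)

blockCount-pos : ∀ {k} (τ : Labelling (suc k)) → 1 ≤ blockCount τ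
blockCount-pos {k} τ = subst (_≤ blockCount τ) (blockCount-top k) (blockCount-mono τ (top (suc k)) (⊑-top τ))

top-≤ᵖ : ∀ {k} (τ : Labelling (suc k)) c → blockCount τ ≡ suc c → (top (suc k) ≤ᵖ τ) ≡ (c ≡ᵇ 0)
top-≤ᵖ {k} τ c |τ|≡1+c = T⇔⇒≡
  (λ top≤τ → let |τ|≤1 = subst (blockCount τ ≤_) (blockCount-top k)
                                (blockCount-mono (top (suc k)) τ (≤ᵖ⇒⊑ (top (suc k)) τ top≤τ)) in
    subst (λ c → T (c ≡ᵇ 0)) (sym (ℕP.n≤0⇒n≡0 (ℕP.≤-pred (subst (_≤ 1) |τ|≡1+c |τ|≤1)))) tt)
  (λ c≡ᵇ0 → top-from-one-block (ℕP.≡ᵇ⇒≡ c 0 c≡ᵇ0))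
  where
    top-from-one-block : c ≡ 0 → T (top (suc k) ≤ᵖ τ)
    top-from-one-block c≡0 with ⊑-dec ℕP._≟_ ℕP._≟_ (top (suc k)) τ
    ... | yes top⊑τ = ⊑⇒≤ᵖ (top (suc k)) τ top⊑τ
    ... | no  top⋢τ = let i , j , same , τi≢τj = ⋢⇒witness (top (suc k)) τ top⋢τ in
      ⊥-elim (ℕP.<-irrefl refl (subst₂ _<_ (blockCount-top k) (trans |τ|≡1+c (cong suc c≡0))
                                       (blockCount-strict τ (top (suc k)) (⊑-top τ) i j same τi≢τj)))

Σ-above-signedFactorial : ∀ k (τ : Labelling (suc k)) →
  Σℤ (Partitions (suc k)) (λ π → ind (τ ≤ᵖ π) (signedFactorial (nBlocks π))) ≡ ind (top (suc k) ≤ᵖ τ) (- 1ℤ)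
Σ-above-signedFactorial k τ = trans (Above.Σ-above signedFactorial (suc k) τ) (by-blocks (blockCount τ) refl (blockCount-pos τ))
  where
    by-blocks : ∀ b → blockCount τ ≡ b → 1 ≤ b → signedUpperSum 0 (nBlocks τ) ≡ ind (top (suc k) ≤ᵖ τ) (- 1ℤ)
    by-blocks (suc c) |τ|≡1+c _ rewrite nBlocks≡blockCount τ | |τ|≡1+c | top-≤ᵖ τ c |τ|≡1+c = signedUpperSum-from-zero c

module Join (n : ℕ) (ρ σ : Labelling n) where

  L : List (Labelling n)
  L = Partitions n

  commonUpper : List (Labelling n)
  commonUpper = filter (λ π → T? ((σ ≤ᵖ π) ∧ (ρ ≤ᵖ π))) L

  -- Position i is labelled by the list of its labels in all common upper bounds.
  profile : Vec (List ℕ) n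
  profile = tabulate (λ i → map (λ π → lookup π i) commonUpper)

  open Canonical (ListP.≡-dec ℕP._≟_) using (canon; canon-IsRgs; ⊑-canon; canon-⊑)

  join : Labelling n
  join = canon profile

  join-∈ : join ∈ L
  join-∈ = IsRgs⇒∈rgs 0 join (canon-IsRgs profile)

  lookup-profile : ∀ i → lookup profile i ≡ map (λ π → lookup π i) commonUpper
  lookup-profile = VecP.lookup∘tabulate (λ i → map (λ π → lookup π i) commonUpper)

  profile-⊑ : ∀ π → π ∈ commonUpper → profile ⊑ π
  profile-⊑ π π∈ i j eq =
    map-≡⇒≡ (λ π → lookup π i) (λ π → lookup π j) commonUpper
            (trans (sym (lookup-profile i)) (trans eq (lookup-profile j))) π∈

  ⊑-profile : ∀ (x : Labelling n) → (∀ π → π ∈ commonUpper → x ⊑ π) → x ⊑ profile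
  ⊑-profile x x⊑ i j eq =
    trans (lookup-profile i)
          (trans (ListP.map-cong-local (All.tabulate λ {π} π∈ → x⊑ π π∈ i j eq)) (sym (lookup-profile j)))

  upper-⊑-join : ∀ x → (∀ π → T ((σ ≤ᵖ π) ∧ (ρ ≤ᵖ π)) → T (x ≤ᵖ π)) → x ⊑ join
  upper-⊑-join x x≤ = ⊑-trans {x = x} {y = profile} {z = join}
    (⊑-profile x (λ π π∈ → ≤ᵖ⇒⊑ x π (x≤ π (proj₂ (∈-filter⁻ (λ π → T? ((σ ≤ᵖ π) ∧ (ρ ≤ᵖ π))) {xs = L} π∈)))))
    (⊑-canon profile)

  σ⊑join : σ ⊑ join
  σ⊑join = upper-⊑-join σ (λ π both → proj₁ (T-∧⁻ both))

  ρ⊑join : ρ ⊑ join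
  ρ⊑join = upper-⊑-join ρ (λ π both → proj₂ (T-∧⁻ {σ ≤ᵖ π} both))

  upper⇔join-≤ : ∀ π → π ∈ L → ((σ ≤ᵖ π) ∧ (ρ ≤ᵖ π)) ≡ (join ≤ᵖ π)
  upper⇔join-≤ π π∈ = T⇔⇒≡
    (λ both → ⊑⇒≤ᵖ join π (⊑-trans {x = join} {y = profile} {z = π} (canon-⊑ profile)
                              (profile-⊑ π (∈-filter⁺ (λ π → T? ((σ ≤ᵖ π) ∧ (ρ ≤ᵖ π))) π∈ both))))
    (λ join≤π → let join⊑π = ≤ᵖ⇒⊑ join π join≤π in
      T-∧⁺ (⊑⇒≤ᵖ σ π (⊑-trans {x = σ} {y = join} {z = π} σ⊑join join⊑π))
           (⊑⇒≤ᵖ ρ π (⊑-trans {x = ρ} {y = join} {z = π} ρ⊑join join⊑π)))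

  joinIsTop⇔ : joinIsTop ρ σ ≡ (top n ≤ᵖ join)
  joinIsTop⇔ = T⇔⇒≡
    (λ all-top → subst (λ b → T (if b then top n ≤ᵖ join else true))
                       (T⇒≡true (T-∧⁺ (⊑⇒≤ᵖ ρ join ρ⊑join) (⊑⇒≤ᵖ σ join σ⊑join)))
                       (All.lookup (AllP.all⁺ _ L all-top) join-∈))
    (λ top≤join → AllP.all⁻ _ (All.tabulate (λ {π} π∈ → top-below-upper top≤join π π∈)))
    where
      top-below-upper : T (top n ≤ᵖ join) → ∀ π → π ∈ L → T (if (ρ ≤ᵖ π) ∧ (σ ≤ᵖ π) then top n ≤ᵖ π else true)
      top-below-upper top≤join π π∈ with (ρ ≤ᵖ π) ∧ (σ ≤ᵖ π) in both
      ... | false = tt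
      ... | true  = ⊑⇒≤ᵖ (top n) π (⊑-trans {x = top n} {y = join} {z = π} (≤ᵖ⇒⊑ (top n) join top≤join)
                      (≤ᵖ⇒⊑ join π (subst T (upper⇔join-≤ π π∈)
                                           (subst T (∧-comm (ρ ≤ᵖ π) (σ ≤ᵖ π)) (≡true⇒T both)))))

Σ-common-upper : ∀ k (ρ σ : Labelling (suc k)) →
  Σℤ (Partitions (suc k)) (λ π → ind ((σ ≤ᵖ π) ∧ (ρ ≤ᵖ π)) (signedFactorial (nBlocks π)))
    ≡ ind (joinIsTop ρ σ) (- 1ℤ)
Σ-common-upper k ρ σ =
  trans (Σ-cong-∈ L (λ π π∈ → cong (λ b → ind b (signedFactorial (nBlocks π))) (upper⇔join-≤ π π∈)))
        (trans (Σ-above-signedFactorial k join) (cong (λ b → ind b (- 1ℤ)) (sym joinIsTop⇔)))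
  where open Join (suc k) ρ σ

P≡Σ-above : ∀ {n} (σ : Labelling n) d →
            P σ d ≡ Σℤ (Partitions n) (λ π → ind (σ ≤ᵖ π) (signedFactorial (nBlocks π) * + fallP d π))
P≡Σ-above {n} σ d =
  trans (Σ-filter (λ π → T? (σ ≤ᵖ π)) (Partitions n) term) (Σ-cong (Partitions n) λ π → cong (ind (σ ≤ᵖ π)) (reorder π))
  where
    term : Labelling n → ℤ
    term π = ((- + 1) ^ nBlocks π) * + (fallP d π ℕ.* ((nBlocks π ∸ 1) !))
    reorder : ∀ π → term π ≡ signedFactorial (nBlocks π) * + fallP d π
    reorder π = trans (cong (((- + 1) ^ nBlocks π) *_) (ℤP.pos-* (fallP d π) ((nBlocks π ∸ 1) !)))
                      (ring ((- + 1) ^ nBlocks π) (+ fallP d π) (+ ((nBlocks π ∸ 1) !)))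
      where ring : ∀ a b c → a * (b * c) ≡ (a * c) * b
            ring = solve-∀

lemma4p4 : (n d : ℕ) → 1 ≤ n → 1 ≤ d →
    (σ : Labelling n) → σ ∈ Partitions n →
    P σ d ≡ - Σℤ (filter (λ ρ → T? (joinIsTop ρ σ)) (Partitions n))
    (λ ρ → ((+ d) ^ nBlocks ρ) * mobius (bot n) ρ)
lemma4p4 (suc k) d _ _ σ _ =
  begin
    P σ d
  ≡⟨ P≡Σ-above σ d ⟩
    Σℤ L (λ π → ind (σ ≤ᵖ π) (signedFactorial (nBlocks π) * + fallP d π))
  ≡⟨ Σ-cong L (λ π → cong (λ x → ind (σ ≤ᵖ π) (signedFactorial (nBlocks π) * x)) (fallP≡Σ-below π)) ⟩
    Σℤ L (λ π → ind (σ ≤ᵖ π) (signedFactorial (nBlocks π) * Σℤ L (λ ρ → ind (ρ ≤ᵖ π) (X ρ))))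
  ≡⟨ Σ-exchange L L (σ ≤ᵖ_) _≤ᵖ_ (λ π → signedFactorial (nBlocks π)) X ⟩
    Σℤ L (λ ρ → Σℤ L (λ π → ind ((σ ≤ᵖ π) ∧ (ρ ≤ᵖ π)) (signedFactorial (nBlocks π))) * X ρ)
  ≡⟨ Σ-cong L (λ ρ → cong (_* X ρ) (Σ-common-upper k ρ σ)) ⟩
    Σℤ L (λ ρ → ind (joinIsTop ρ σ) (- 1ℤ) * X ρ)
  ≡⟨ Σ-negated-filter L (λ ρ → joinIsTop ρ σ) X ⟩
    - Σℤ (filter (λ ρ → T? (joinIsTop ρ σ)) L) X
  ∎
  where
    open ≡-Reasoning
    open Möbius (suc k) using (L; μ)
    open Expansion (suc k) d using (fallP≡Σ-below)
    X : Labelling (suc k) → ℤ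
    X ρ = ((+ d) ^ nBlocks ρ) * μ ρ
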